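{- Let $P$ be a finite graded bounded poset with minimum $\widehat0$. Then its $\chi$-Chow polynomial and left augmented $\chi$-Chow polynomial satisfy $$\mathrm{H}_P(x)=1+x\sum_{t\in P,\ \rho(t)>1}\mathrm{H}_{\operatorname{trunc}([\widehat0,t])}(x),\qquad G_P(x)=1+x\sum_{t\ne\widehat0}G_{\operatorname{trunc}([\widehat0,t])}(x).$$
   Context: For a finite graded bounded poset $P$ with rank function $\rho$ ($\rho_{st}=\rho(t)-\rho(s)$), the characteristic function is $\chi_{st}(x)=\sum_{s\le w\le t}\mu_{sw}x^{\rho_{wt}}$ (Möbius function $\mu$), an element of the incidence algebra (maps $[s,t]\mapsto a_{st}(x)\in\mathbb{Z}[x]$ with product $(ab)_{st}=\sum_{s\le w\le t}a_{sw}b_{wt}$). For $s<t$, $\chi_{st}$ is divisible by $x-1$; let $\overline{\chi}_{st}=\chi_{st}/(x-1)$ for $s<t$ and $\overline{\chi}_{ss}=-1$. The $\chi$-Chow function is $\mathrm{H}=-(\overline{\chi})^{ -1}$ and $\mathrm{H}_P=\mathrm{H}_{\widehat0\widehat1}$ (for a one-element poset this is $1$). The left augmented $\chi$-Chow function is $G_{st}(x)=\sum_{s\le w\le t}x^{\rho_{sw}}\mathrm{H}_{wt}(x)$, and $G_P=G_{\widehat0\widehat1}$. For a graded bounded poset $Q$, $\operatorname{trunc}(Q)$ is the subposet of $Q$ consisting of all elements except the coatoms of $Q$; the polynomials $\mathrm{H}_{\operatorname{trunc}(Q)}$, $G_{\operatorname{trunc}(Q)}$ are computed for this poset with the induced rank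 function from $Q$ (so rank differences are those of $Q$). -}

module Defs where

open import Level using (0ℓ)
open import Data.Nat using (ℕ; zero; suc; _∸_; _≡ᵇ_)
open import Data.Integer using (ℤ; +_; -_) renaming (_+_ to _+ℤ_; _*_ to _*ℤ_)
open import Data.Fin using (Fin; zero; suc)
open import Data.Fin.Properties using (all?; _≟_)
open import Data.Bool using (Bool; true; false; if_then_else_; _∧_; not)
open import Data.Product using (_×_; _,_)
open import Data.Sum using (_⊎_)
open import Relation.Binary using (Rel; IsPartialOrder; Decidable)
open import Relation.Binary.PropositionalEquality using (_≡_)
open import Relation.Nullary using (¬_; Dec)
open import Relation.Nullary.Decidable using (⌊_⌋; _×-dec_; _→-dec_; _⊎-dec_; ¬?)

-- Polynomials in ℤ[x], represented by their coefficient sequences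
-- (coefficient of x^i at index i).  Equality is coefficientwise.

Poly : Set
Poly = ℕ → ℤ

infix 4 _≈P_
_≈P_ : Poly → Poly → Set
p ≈P q = ∀ i → p i ≡ q i

xpow : ℕ → Poly
xpow k i = if i ≡ᵇ k then + 1 else + 0

0P 1P : Poly
0P _ = + 0
1P = xpow 0

infixl 6 _+P_
infixl 7 _*P_ _·P_

_+P_ : Poly → Poly → Poly
(p +P q) i = p i +ℤ q i

-P_ : Poly → Poly
(-P p) i = - p i

_·P_ : ℤ → Poly → Poly
(c ·P p) i = c *ℤ p i

sumTo : ℕ → (ℕ → ℤ) → ℤ
sumTo zero    f = f 0
sumTo (suc m) f = sumTo m f +ℤ f (suc m)

_*P_ : Poly → Poly → Poly
(p *P q) m = sumTo m (λ i → p i *ℤ q (m ∸ i))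

-- Division by (x - 1): the quotient q with (x-1) q = p is q = -p(1+x+x²+…),
-- i.e. q_m = -(p₀+…+p_m).  This is the exact polynomial quotient whenever
-- (x-1) divides p (which is the only case in which it is used).
divByXMinus1 : Poly → Poly
divByXMinus1 p m = - sumTo m p

ΣP : ∀ {n} → (Fin n → Poly) → Poly
ΣP {zero}  f = 0P
ΣP {suc n} f = f zero +P ΣP (λ i → f (suc i))

Σℤ : ∀ {n} → (Fin n → ℤ) → ℤ
Σℤ {zero}  f = + 0
Σℤ {suc n} f = f zero +ℤ Σℤ (λ i → f (suc i))

[_]P : Bool → Poly → Poly
[ b ]P p = if b then p else 0P

[_]ℤ : Bool → ℤ → ℤ
[ b ]ℤ c = if b then c else + 0

Covers : ∀ {n} → Rel (Fin n) 0ℓ → Fin n → Fin n → Set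
Covers _≤_ s t = (s ≤ t) × (¬ s ≡ t) × (∀ z → s ≤ z → z ≤ t → (z ≡ s) ⊎ (z ≡ t))

record FinGradedBoundedPoset : Set₁ where
  field
    n              : ℕ
    _≤_            : Rel (Fin n) 0ℓ
    isPartialOrder : IsPartialOrder _≡_ _≤_
    _≤?_           : Decidable _≤_
    𝟘              : Fin n
    𝟙              : Fin n
    𝟘-min          : ∀ x → 𝟘 ≤ x
    𝟙-max          : ∀ x → x ≤ 𝟙
    ρ              : Fin n → ℕ
    ρ-𝟘            : ρ 𝟘 ≡ 0
    ρ-cover        : ∀ s t → Covers _≤_ s t → ρ t ≡ suc (ρ s)

module _ (P : FinGradedBoundedPoset) where
  open FinGradedBoundedPoset P

  covers? : (s t : Fin n) → Dec (Covers _≤_ s t)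
  covers? s t = (s ≤? t) ×-dec (¬? (s ≟ t)) ×-dec
                all? (λ z → (s ≤? z) →-dec ((z ≤? t) →-dec ((z ≟ s) ⊎-dec (z ≟ t))))

  private
    _≤ᵇ_ _==_ : Fin n → Fin n → Bool
    s ≤ᵇ t = ⌊ s ≤? t ⌋
    s == t = ⌊ s ≟ t ⌋

  -- All functions below are relative to a subposet S ⊆ P (given by its
  -- membership test) with the order induced from P and a rank function r.
  -- Recursions use fuel n (number of elements of P), which exceeds the
  -- length of every chain, so the fuel never runs out on intervals.

  mobiusF : (S : Fin n → Bool) → ℕ → Fin n → Fin n → ℤ
  mobiusF S zero    s t = + 0
  mobiusF S (suc k) s t =
    if s == t then + 1
    else [ s ≤ᵇ t ]ℤ (- Σℤ (λ w → [ S w ∧ (s ≤ᵇ w) ∧ (w ≤ᵇ t) ∧ not (w == t) ]ℤ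
                                      (mobiusF S k s w)))

  mobius : (S : Fin n → Bool) → Fin n → Fin n → ℤ
  mobius S = mobiusF S n

  charF : (S : Fin n → Bool) (r : Fin n → ℕ) → Fin n → Fin n → Poly
  charF S r s t = ΣP (λ w → [ S w ∧ (s ≤ᵇ w) ∧ (w ≤ᵇ t) ]P
                              (mobius S s w ·P xpow (r t ∸ r w)))

  charBar : (S : Fin n → Bool) (r : Fin n → ℕ) → Fin n → Fin n → Poly
  charBar S r s t = if s == t then -P 1P else divByXMinus1 (charF S r s t)

  -- χ-Chow function H = -(χ̄)⁻¹ : H_{ss} = 1 and, for s < t,
  -- H_{st} = Σ_{s<w≤t} χ̄_{sw} H_{wt}  (equivalent to  Σ_{s≤w≤t} χ̄_{sw} H_{wt} = 0)
  chowF : (S : Fin n → Bool) (r : Fin n → ℕ) → ℕ → Fin n → Fin n → Poly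
  chowF S r zero    s t = 0P
  chowF S r (suc k) s t =
    if s == t then 1P
    else ΣP (λ w → [ S w ∧ (s ≤ᵇ w) ∧ (w ≤ᵇ t) ∧ not (w == s) ]P
                     (charBar S r s w *P chowF S r k w t))

  chow : (S : Fin n → Bool) (r : Fin n → ℕ) → Fin n → Fin n → Poly
  chow S r = chowF S r n

  augChow : (S : Fin n → Bool) (r : Fin n → ℕ) → Fin n → Fin n → Poly
  augChow S r s t = ΣP (λ w → [ S w ∧ (s ≤ᵇ w) ∧ (w ≤ᵇ t) ]P
                               (xpow (r w ∸ r s) *P chow S r w t))

  everything : Fin n → Bool
  everything _ = true

  chowPoly : Poly
  chowPoly = chow everything ρ 𝟘 𝟙

  augChowPoly : Poly
  augChowPoly = augChow everything ρ 𝟘 𝟙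

  trunc : Fin n → (Fin n → Bool)
  trunc t w = (w ≤ᵇ t) ∧ not ⌊ covers? w t ⌋

  -- its minimum: 0̂, unless 0̂ is itself a coatom of [0̂,t] (ρ(t) = 1),
  -- in which case trunc([0̂,t]) = {t}
  truncBot : Fin n → Fin n
  truncBot t = if ⌊ covers? 𝟘 t ⌋ then t else 𝟘

  -- rank function of trunc([0̂,t]): that of P on
  -- all elements except the top t, which gets rank ρ(t) - 1 (the rank it
  -- has in the graded poset trunc([0̂,t]), where t covers the old
  -- corank-2 elements)
  truncRank : Fin n → (Fin n → ℕ)
  truncRank t w = if w == t then ρ t ∸ 1 else ρ w

  chowTrunc : Fin n → Poly
  chowTrunc t = chow (trunc t) (truncRank t) (truncBot t) t

  augChowTrunc : Fin n → Poly
  augChowTrunc t = augChow (trunc t) (truncRank t) (truncBot t) t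

-- Since Σ_{s ≤ w ≤ t} μ_sw = 0, the reduced characteristic function is χ̄_st = Σ_{s ≤ w < t} μ_sw [ρ_wt]ₓ,
-- where [e]ₓ = 1 + x + ⋯ + x^(e-1). Over a cover this is 1 = -μ_st.
-- In trunc([0̂,t]) the coatoms of [s,t] are missing and the rank of t drops by one; peeling the
-- constant term off every [ρ_wt]ₓ therefore gives x χ̄ᵗʳᵘⁿᶜ_st = χ̄_st + μ_st. Now induct upwards on s
-- in the recursion H_su = Σ_{s < w ≤ u} χ̄_sw H_wu of H = -χ̄⁻¹, assuming H_wu = 1 + x Σ_{w <₂ t ≤ u} H_{trunc[w,t]}
-- (s <₂ t meaning ρ_st ≥ 2). The first summand Σ_w χ̄_sw gives 1 (covers, via Σ_{s < w ≤ u} μ_sw = -1) plus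
-- Σ_{s <₂ t ≤ u} (χ̄_st + μ_st); regrouping the double sum over chains s < w <₂ t ≤ u by t and using the
-- recursion of H in trunc([s,t]) turns each group into x H_{trunc[s,t]}. At s = 0̂, u = 1̂ this is the formula
-- for H_P, and summing x^ρ(w) H_{w1̂} = x^ρ(w) + x Σ_t … over w regroups into the formula for G_P.

module Submission where

open import Algebra.Bundles using (CommutativeMonoid)
import Algebra.Construct.Pointwise as Pointwise
import Algebra.Properties.CommutativeSemigroup as CommutativeSemigroupProperties
open import Data.Bool using (Bool; true; false; T; not; _∧_; if_then_else_)
open import Data.Bool.Properties using (T-≡)
open import Data.Fin using (Fin; zero; suc)
open import Data.Fin.Induction using (po-wellFounded; po-noetherian)
open import Data.Fin.Properties using (_≟_; suc-injective; ¬∀⟶∃¬)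
open import Data.Fin.Subset using (Subset; _∈_; ∣_∣)
open import Data.Fin.Subset.Properties using (p⊂q⇒∣p∣<∣q∣; ∣⊥∣≡0; ⊆-min; ∉⊥; ∣p∣≤n)
open import Data.Integer as ℤ using (ℤ; +_; -_; _+_; _*_)
import Data.Integer.Properties as ℤ
open import Data.Integer.Tactic.RingSolver using (solve-∀)
open import Data.Nat as ℕ using (ℕ; zero; suc; _∸_; _<ᵇ_)
import Data.Nat.Properties as ℕ
open import Data.Product using (_×_; _,_; ∃; proj₁; proj₂)
open import Data.Sum using (_⊎_; inj₁; inj₂)
open import Data.Unit using (⊤)
open import Data.Vec using (tabulate)
open import Data.Vec.Properties using (lookup∘tabulate; lookup⇒[]=; []=⇒lookup)
open import Function using (_∘_; flip; id; const)
open import Function.Bundles using (Equivalence)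
open import Induction.WellFounded using (Acc; acc)
open import Level using (0ℓ)
open import Relation.Binary using (IsPartialOrder)
import Relation.Binary.PropositionalEquality as ≡
open ≡ using (_≡_; _≢_)
import Relation.Binary.Reasoning.Setoid
open import Relation.Nullary using (¬_; Dec; yes; no; contradiction)
open import Relation.Nullary.Decidable using (⌊_⌋; toWitness; fromWitness; _×-dec_; _→-dec_; _⊎-dec_; ¬?)
open import Relation.Nullary.Reflects using (Reflects; ofʸ; ofⁿ; ¬-reflects; T-reflects; _×-reflects_; det)

open import Defs

⌊⌋-reflects : ∀ {a} {A : Set a} (a? : Dec A) → Reflects A ⌊ a? ⌋
⌊⌋-reflects (yes a) = ofʸ a
⌊⌋-reflects (no ¬a) = ofⁿ ¬a

T-intro : ∀ {a} {A : Set a} {b} → Reflects A b → A → T b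
T-intro (ofʸ _)  _ = _
T-intro (ofⁿ ¬a) a = contradiction a ¬a

if-⌊⌋-yes : ∀ {a b} {A : Set a} {B : Set b} (a? : Dec A) {x y : B} → A → (if ⌊ a? ⌋ then x else y) ≡ x
if-⌊⌋-yes (yes _) _ = ≡.refl
if-⌊⌋-yes (no ¬a) a = contradiction a ¬a

if-⌊⌋-no : ∀ {a b} {A : Set a} {B : Set b} (a? : Dec A) {x y : B} → ¬ A → (if ⌊ a? ⌋ then x else y) ≡ y
if-⌊⌋-no (yes a) ¬a = contradiction a ¬a
if-⌊⌋-no (no _)  _  = ≡.refl

module Summation {c ℓ} (M : CommutativeMonoid c ℓ)
  (Σ : ∀ {n} → (Fin n → CommutativeMonoid.Carrier M) → CommutativeMonoid.Carrier M)
  (Σ-[] : ∀ f → Σ {0} f ≡ CommutativeMonoid.ε M)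
  (Σ-∷ : ∀ {n} f → Σ {suc n} f ≡ CommutativeMonoid._∙_ M (f zero) (Σ (f ∘ suc)))
  where

  open import Algebra.Properties.CommutativeMonoid.Sum M
    using (sum; sum-cong-≋; ∑-distrib-+; ∑-comm; sum-replicate-zero)
  open CommutativeMonoid M
    using (Carrier; _≈_; _∙_; ε; setoid; refl; sym; trans; reflexive; identityˡ; identityʳ; ∙-cong; ∙-congˡ; ∙-congʳ)
  open import Relation.Binary.Reasoning.Setoid setoid

  private
    Σ≈sum : ∀ {n} (f : Fin n → Carrier) → Σ f ≈ sum f
    Σ≈sum {zero}  f = reflexive (Σ-[] f)
    Σ≈sum {suc n} f = trans (reflexive (Σ-∷ f)) (∙-congˡ (Σ≈sum (f ∘ suc)))

  cong : ∀ {n} {f g : Fin n → Carrier} → (∀ i → f i ≈ g i) → Σ f ≈ Σ g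
  cong {f = f} {g} f≈g = begin
    Σ f   ≈⟨ Σ≈sum f ⟩
    sum f ≈⟨ sum-cong-≋ f≈g ⟩
    sum g ≈⟨ Σ≈sum g ⟨
    Σ g   ∎

  distrib : ∀ {n} (f g : Fin n → Carrier) → Σ (λ i → f i ∙ g i) ≈ Σ f ∙ Σ g
  distrib f g = begin
    Σ (λ i → f i ∙ g i)   ≈⟨ Σ≈sum _ ⟩
    sum (λ i → f i ∙ g i) ≈⟨ ∑-distrib-+ f g ⟩
    sum f ∙ sum g         ≈⟨ ∙-cong (Σ≈sum f) (Σ≈sum g) ⟨
    Σ f ∙ Σ g             ∎

  comm : ∀ {m n} (f : Fin m → Fin n → Carrier) →
         Σ (λ i → Σ (λ j → f i j)) ≈ Σ (λ j → Σ (λ i → f i j))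
  comm f = begin
    Σ (λ i → Σ (f i))                   ≈⟨ cong (λ i → Σ≈sum (f i)) ⟩
    Σ (λ i → sum (f i))                 ≈⟨ Σ≈sum _ ⟩
    sum (λ i → sum (f i))               ≈⟨ ∑-comm f ⟩
    sum (λ j → sum (λ i → f i j))       ≈⟨ Σ≈sum _ ⟨
    Σ (λ j → sum (λ i → f i j))         ≈⟨ cong (λ j → Σ≈sum (λ i → f i j)) ⟨
    Σ (λ j → Σ (λ i → f i j))           ∎

  vanishing : ∀ {n} {f : Fin n → Carrier} → (∀ i → f i ≈ ε) → Σ f ≈ ε
  vanishing {n} f≈ε = trans (cong f≈ε) (trans (Σ≈sum _) (sum-replicate-zero n))

  concentrated : ∀ {n} {f : Fin n → Carrier} (j : Fin n) → (∀ i → i ≢ j → f i ≈ ε) → Σ f ≈ f j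
  concentrated {suc n} {f} zero    f≈ε = begin
    Σ f                  ≡⟨ Σ-∷ f ⟩
    f zero ∙ Σ (f ∘ suc) ≈⟨ ∙-congˡ (vanishing (λ i → f≈ε (suc i) λ ())) ⟩
    f zero ∙ ε           ≈⟨ identityʳ _ ⟩
    f zero               ∎
  concentrated {suc n} {f} (suc j) f≈ε = begin
    Σ f                  ≡⟨ Σ-∷ f ⟩
    f zero ∙ Σ (f ∘ suc) ≈⟨ ∙-cong (f≈ε zero λ ()) (concentrated j (λ i i≢j → f≈ε (suc i) (i≢j ∘ suc-injective))) ⟩
    ε ∙ f (suc j)        ≈⟨ identityˡ _ ⟩
    f (suc j)            ∎

  homomorphic : (φ : Carrier → Carrier) → (∀ {x y} → x ≈ y → φ x ≈ φ y) →
                (∀ x y → φ (x ∙ y) ≈ φ x ∙ φ y) → φ ε ≈ ε →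
                ∀ {n} (f : Fin n → Carrier) → φ (Σ f) ≈ Σ (φ ∘ f)
  homomorphic φ φ-cong φ-∙ φ-ε {zero}  f = begin
    φ (Σ f)   ≈⟨ φ-cong (reflexive (Σ-[] f)) ⟩
    φ ε       ≈⟨ φ-ε ⟩
    ε         ≡⟨ Σ-[] (φ ∘ f) ⟨
    Σ (φ ∘ f) ∎
  homomorphic φ φ-cong φ-∙ φ-ε {suc n} f = begin
    φ (Σ f)                      ≈⟨ φ-cong (reflexive (Σ-∷ f)) ⟩
    φ (f zero ∙ Σ (f ∘ suc))     ≈⟨ φ-∙ _ _ ⟩
    φ (f zero) ∙ φ (Σ (f ∘ suc)) ≈⟨ ∙-congˡ (homomorphic φ φ-cong φ-∙ φ-ε (f ∘ suc)) ⟩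
    φ (f zero) ∙ Σ (φ ∘ f ∘ suc) ≡⟨ Σ-∷ (φ ∘ f) ⟨
    Σ (φ ∘ f)                    ∎

  [_]_ : Bool → Carrier → Carrier
  [ b ] x = if b then x else ε

  indicator-cong : ∀ {a b} {A : Set a} {B : Set b} {p q x y} → Reflects A p → Reflects B q →
                   (A → B) → (B → A) → (A → x ≈ y) → [ p ] x ≈ [ q ] y
  indicator-cong (ofʸ a) (ofʸ _)  _   _   x≈y = x≈y a
  indicator-cong (ofʸ a) (ofⁿ ¬b) A→B _   _   = contradiction (A→B a) ¬b
  indicator-cong (ofⁿ ¬a) (ofʸ b) _   B→A _   = contradiction (B→A b) ¬a
  indicator-cong (ofⁿ _) (ofⁿ _)  _   _   _   = refl

  indicator-congʳ : ∀ {a} {A : Set a} {p x y} → Reflects A p → (A → x ≈ y) → [ p ] x ≈ [ p ] y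
  indicator-congʳ r = indicator-cong r r id id

  indicator-true : ∀ {a} {A : Set a} {p x} → Reflects A p → A → [ p ] x ≈ x
  indicator-true (ofʸ _)  _ = refl
  indicator-true (ofⁿ ¬a) a = contradiction a ¬a

  indicator-false : ∀ {a} {A : Set a} {p x} → Reflects A p → ¬ A → [ p ] x ≈ ε
  indicator-false (ofʸ a) ¬a = contradiction a ¬a
  indicator-false (ofⁿ _) _  = refl

  indicator-ε : ∀ p {x} → x ≈ ε → [ p ] x ≈ ε
  indicator-ε true  x≈ε = x≈ε
  indicator-ε false _   = refl

  indicator-∧ : ∀ p q x → [ p ] ([ q ] x) ≡ [ p ∧ q ] x
  indicator-∧ true  q x = ≡.refl
  indicator-∧ false q x = ≡.refl

  indicator-∙ : ∀ p x y → [ p ] (x ∙ y) ≈ [ p ] x ∙ [ p ] y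
  indicator-∙ true  x y = refl
  indicator-∙ false x y = sym (identityˡ ε)

  indicator-homomorphic : (φ : Carrier → Carrier) → φ ε ≈ ε → ∀ p x → φ ([ p ] x) ≈ [ p ] (φ x)
  indicator-homomorphic φ φ-ε true  x = refl
  indicator-homomorphic φ φ-ε false x = φ-ε

  indicator-Σ : ∀ p {n} (f : Fin n → Carrier) → [ p ] Σ f ≈ Σ (λ i → [ p ] f i)
  indicator-Σ p = homomorphic ([ p ]_) (indicator-congʳ (T-reflects p) ∘ const) (indicator-∙ p) (indicator-ε p refl)

  split : ∀ {n} (j : Fin n) (f : Fin n → Carrier) →
          Σ f ≈ f j ∙ Σ (λ i → [ not ⌊ i ≟ j ⌋ ] f i)
  split j f = begin
    Σ f                                                    ≈⟨ cong (λ i → decompose (i ≟ j)) ⟩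
    Σ (λ i → [ ⌊ i ≟ j ⌋ ] f i ∙ [ not ⌊ i ≟ j ⌋ ] f i)   ≈⟨ distrib _ _ ⟩
    Σ (λ i → [ ⌊ i ≟ j ⌋ ] f i) ∙ Σ (λ i → [ not ⌊ i ≟ j ⌋ ] f i)
      ≈⟨ ∙-congʳ (concentrated j (λ i i≢j → indicator-false (⌊⌋-reflects (i ≟ j)) i≢j)) ⟩
    [ ⌊ j ≟ j ⌋ ] f j ∙ Σ (λ i → [ not ⌊ i ≟ j ⌋ ] f i)  ≈⟨ ∙-congʳ (indicator-true (⌊⌋-reflects (j ≟ j)) ≡.refl) ⟩
    f j ∙ Σ (λ i → [ not ⌊ i ≟ j ⌋ ] f i)                 ∎
    where
    decompose : ∀ {i} (d : Dec (i ≡ j)) → f i ≈ [ ⌊ d ⌋ ] f i ∙ [ not ⌊ d ⌋ ] f i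
    decompose (yes _) = sym (identityʳ _)
    decompose (no _)  = sym (identityˡ _)

open ≡ using (refl; sym; trans; cong; cong₂; subst)

polyMonoid : CommutativeMonoid 0ℓ 0ℓ
polyMonoid = Pointwise.commutativeMonoid ℕ ℤ.+-0-commutativeMonoid

module Σℤ = Summation ℤ.+-0-commutativeMonoid Σℤ (λ _ → refl) (λ _ → refl)
module ΣP = Summation polyMonoid ΣP (λ _ → refl) (λ _ → refl)

open CommutativeMonoid polyMonoid public using ()
  renaming ( setoid to ≈P-setoid; refl to ≈P-refl; sym to ≈P-sym; trans to ≈P-trans
           ; reflexive to ≈P-reflexive; ∙-cong to +P-cong; ∙-congˡ to +P-congˡ; ∙-congʳ to +P-congʳ
           ; assoc to +P-assoc; comm to +P-comm; identityˡ to +P-identityˡ; identityʳ to +P-identityʳ)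

module ℤ+ = CommutativeSemigroupProperties ℤ.+-commutativeSemigroup

module ≈P-Reasoning = Relation.Binary.Reasoning.Setoid ≈P-setoid

shift : Poly → Poly
shift p zero    = + 0
shift p (suc m) = p m

shift-cong : ∀ {p q} → p ≈P q → shift p ≈P shift q
shift-cong p≈q zero    = refl
shift-cong p≈q (suc m) = p≈q m

shift-+ : ∀ p q → shift (p +P q) ≈P shift p +P shift q
shift-+ p q zero    = refl
shift-+ p q (suc m) = refl

shift-zero : shift 0P ≈P 0P
shift-zero zero    = refl
shift-zero (suc m) = refl

xpow-suc : ∀ k → xpow (suc k) ≈P shift (xpow k)
xpow-suc k zero    = refl
xpow-suc k (suc m) = refl

shift-ΣP : ∀ {n} (f : Fin n → Poly) → shift (ΣP f) ≈P ΣP (shift ∘ f)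
shift-ΣP = ΣP.homomorphic shift shift-cong shift-+ shift-zero

sumTo-cong : ∀ m {f g : ℕ → ℤ} → (∀ i → i ℕ.≤ m → f i ≡ g i) → sumTo m f ≡ sumTo m g
sumTo-cong zero    f≗g = f≗g 0 ℕ.z≤n
sumTo-cong (suc m) f≗g = cong₂ _+_ (sumTo-cong m (λ i i≤m → f≗g i (ℕ.m≤n⇒m≤1+n i≤m))) (f≗g (suc m) ℕ.≤-refl)

sumTo-+ : ∀ m (f g : ℕ → ℤ) → sumTo m (λ i → f i + g i) ≡ sumTo m f + sumTo m g
sumTo-+ zero    f g = refl
sumTo-+ (suc m) f g = trans (cong (_+ (f (suc m) + g (suc m))) (sumTo-+ m f g))
                            (ℤ+.interchange (sumTo m f) (sumTo m g) (f (suc m)) (g (suc m)))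

sumTo-zero : ∀ m {f : ℕ → ℤ} → (∀ i → i ℕ.≤ m → f i ≡ + 0) → sumTo m f ≡ + 0
sumTo-zero zero    f≗0 = f≗0 0 ℕ.z≤n
sumTo-zero (suc m) f≗0 = cong₂ _+_ (sumTo-zero m (λ i i≤m → f≗0 i (ℕ.m≤n⇒m≤1+n i≤m))) (f≗0 (suc m) ℕ.≤-refl)

sumTo-*ˡ : ∀ m c (f : ℕ → ℤ) → sumTo m (λ i → c * f i) ≡ c * sumTo m f
sumTo-*ˡ zero    c f = refl
sumTo-*ˡ (suc m) c f = trans (cong (_+ c * f (suc m)) (sumTo-*ˡ m c f))
                             (sym (ℤ.*-distribˡ-+ c (sumTo m f) (f (suc m))))

sumTo-suc : ∀ m (f : ℕ → ℤ) → sumTo (suc m) f ≡ f 0 + sumTo m (f ∘ suc)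
sumTo-suc zero    f = refl
sumTo-suc (suc m) f = trans (cong (_+ f (suc (suc m))) (sumTo-suc m f)) (ℤ.+-assoc (f 0) _ _)

*P-cong : ∀ {p p′ q q′} → p ≈P p′ → q ≈P q′ → p *P q ≈P p′ *P q′
*P-cong p≈p′ q≈q′ m = sumTo-cong m (λ i _ → cong₂ _*_ (p≈p′ i) (q≈q′ (m ∸ i)))

*P-distribˡ-+P : ∀ p q r → p *P (q +P r) ≈P p *P q +P p *P r
*P-distribˡ-+P p q r m =
  trans (sumTo-cong m (λ i _ → ℤ.*-distribˡ-+ (p i) (q (m ∸ i)) (r (m ∸ i)))) (sumTo-+ m _ _)

*P-zeroʳ : ∀ p → p *P 0P ≈P 0P
*P-zeroʳ p m = sumTo-zero m (λ i _ → ℤ.*-zeroʳ (p i))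

*P-distribˡ-ΣP : ∀ p {n} (f : Fin n → Poly) → p *P ΣP f ≈P ΣP (λ w → p *P f w)
*P-distribˡ-ΣP p = ΣP.homomorphic (p *P_) (*P-cong {p} ≈P-refl) (*P-distribˡ-+P p) (*P-zeroʳ p)

*P-identityʳ : ∀ p → p *P 1P ≈P p
*P-identityʳ p zero    = ℤ.*-identityʳ (p 0)
*P-identityʳ p (suc m) = begin
  sumTo m (λ i → p i * 1P (suc m ∸ i)) + p (suc m) * 1P (m ∸ m)
    ≡⟨ cong₂ _+_ (sumTo-zero m (λ i i≤m → trans (cong (λ k → p i * 1P k) (ℕ.+-∸-assoc 1 i≤m)) (ℤ.*-zeroʳ (p i))))
                 (trans (cong (λ k → p (suc m) * 1P k) (ℕ.n∸n≡0 m)) (ℤ.*-identityʳ (p (suc m)))) ⟩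
  + 0 + p (suc m)
    ≡⟨ ℤ.+-identityˡ (p (suc m)) ⟩
  p (suc m) ∎
  where open ≡.≡-Reasoning

*P-identityˡ : ∀ p → 1P *P p ≈P p
*P-identityˡ p zero    = ℤ.*-identityˡ (p 0)
*P-identityˡ p (suc m) = begin
  sumTo (suc m) (λ i → 1P i * p (suc m ∸ i))
    ≡⟨ sumTo-suc m _ ⟩
  + 1 * p (suc m) + sumTo m (λ i → + 0 * p (m ∸ i))
    ≡⟨ cong₂ _+_ (ℤ.*-identityˡ (p (suc m))) (sumTo-zero m (λ i _ → ℤ.*-zeroˡ (p (m ∸ i)))) ⟩
  p (suc m) + + 0
    ≡⟨ ℤ.+-identityʳ (p (suc m)) ⟩
  p (suc m) ∎
  where open ≡.≡-Reasoning

*P-shiftʳ : ∀ p q → p *P shift q ≈P shift (p *P q)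
*P-shiftʳ p q zero    = ℤ.*-zeroʳ (p 0)
*P-shiftʳ p q (suc m) = begin
  sumTo m (λ i → p i * shift q (suc m ∸ i)) + p (suc m) * shift q (m ∸ m)
    ≡⟨ cong₂ _+_ (sumTo-cong m (λ i i≤m → cong (λ k → p i * shift q k) (ℕ.+-∸-assoc 1 i≤m)))
                 (trans (cong (λ k → p (suc m) * shift q k) (ℕ.n∸n≡0 m)) (ℤ.*-zeroʳ (p (suc m)))) ⟩
  sumTo m (λ i → p i * q (m ∸ i)) + + 0
    ≡⟨ ℤ.+-identityʳ _ ⟩
  sumTo m (λ i → p i * q (m ∸ i)) ∎
  where open ≡.≡-Reasoning

x*P≈shift : ∀ p → xpow 1 *P p ≈P shift p
x*P≈shift p zero    = ℤ.*-zeroˡ (p 0)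
x*P≈shift p (suc m) = begin
  sumTo (suc m) (λ i → xpow 1 i * p (suc m ∸ i))
    ≡⟨ sumTo-suc m _ ⟩
  + 0 * p (suc m) + (1P *P p) m
    ≡⟨ cong₂ _+_ (ℤ.*-zeroˡ (p (suc m))) (*P-identityˡ p m) ⟩
  + 0 + p m
    ≡⟨ ℤ.+-identityˡ (p m) ⟩
  p m ∎
  where open ≡.≡-Reasoning

ΣP-·P : ∀ {n} (c : Fin n → ℤ) p → ΣP (λ w → c w ·P p) ≈P Σℤ c ·P p
ΣP-·P {zero}  c p i = sym (ℤ.*-zeroˡ (p i))
ΣP-·P {suc n} c p i =
  trans (cong (_+_ (c zero * p i)) (ΣP-·P (c ∘ suc) p i)) (sym (ℤ.*-distribʳ-+ (p i) (c zero) _))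

·P-distrib-+P : ∀ c p q → c ·P (p +P q) ≈P c ·P p +P c ·P q
·P-distrib-+P c p q i = ℤ.*-distribˡ-+ c (p i) (q i)

·P-shift : ∀ c p → c ·P shift p ≈P shift (c ·P p)
·P-shift c p zero    = ℤ.*-zeroʳ c
·P-shift c p (suc m) = refl

indicator-·P : ∀ b c p → [ b ]P (c ·P p) ≈P [ b ]ℤ c ·P p
indicator-·P true  c p i = refl
indicator-·P false c p i = sym (ℤ.*-zeroˡ (p i))

ΣP-indicator-·P : ∀ {n} (b : Fin n → Bool) (c : Fin n → ℤ) p →
                  ΣP (λ w → [ b w ]P (c w ·P p)) ≈P Σℤ (λ w → [ b w ]ℤ (c w)) ·P p
ΣP-indicator-·P b c p = ≈P-trans (ΣP.cong (λ w → indicator-·P (b w) (c w) p)) (ΣP-·P (λ w → [ b w ]ℤ (c w)) p)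

Σℤ-indicator-neg : ∀ {n} (b : Fin n → Bool) (c : Fin n → ℤ) → Σℤ (λ w → [ b w ]ℤ (- c w)) ≡ - Σℤ (λ w → [ b w ]ℤ (c w))
Σℤ-indicator-neg b c = trans (Σℤ.cong (λ w → sym (Σℤ.indicator-homomorphic -_ refl (b w) (c w))))
                             (sym (Σℤ.homomorphic -_ (cong -_) ℤ.neg-distrib-+ refl (λ w → [ b w ]ℤ (c w))))

qInt : ℕ → Poly
qInt e m = [ m <ᵇ e ]ℤ (+ 1)

qInt-suc : ∀ e → qInt (suc e) ≈P 1P +P shift (qInt e)
qInt-suc e zero    = refl
qInt-suc e (suc m) = sym (ℤ.+-identityˡ (qInt e m))

qInt-peel : ∀ c {e} → 0 ℕ.< e → c ·P qInt e ≈P c ·P 1P +P shift (c ·P qInt (e ∸ 1))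
qInt-peel c {suc e} _ = ≈P-trans (λ i → cong (c *_) (qInt-suc e i))
  (≈P-trans (·P-distrib-+P c 1P (shift (qInt e))) (+P-congˡ {c ·P 1P} (·P-shift c (qInt e))))

qInt-step : ∀ e m → xpow e (suc m) + qInt e (suc m) ≡ qInt e m
qInt-step zero          m       = refl
qInt-step (suc zero)    zero    = refl
qInt-step (suc (suc e)) zero    = refl
qInt-step (suc e)       (suc m) = qInt-step e m

sumTo-xpow : ∀ e m → sumTo m (xpow e) + qInt e m ≡ + 1
sumTo-xpow zero    zero    = refl
sumTo-xpow (suc e) zero    = refl
sumTo-xpow e       (suc m) = begin
  sumTo m (xpow e) + xpow e (suc m) + qInt e (suc m)   ≡⟨ ℤ.+-assoc (sumTo m (xpow e)) _ _ ⟩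
  sumTo m (xpow e) + (xpow e (suc m) + qInt e (suc m)) ≡⟨ cong (_+_ (sumTo m (xpow e))) (qInt-step e m) ⟩
  sumTo m (xpow e) + qInt e m                          ≡⟨ sumTo-xpow e m ⟩
  + 1                                                  ∎
  where open ≡.≡-Reasoning

ones : Poly
ones _ = + 1

divByXMinus1-cong : ∀ {p q} → p ≈P q → divByXMinus1 p ≈P divByXMinus1 q
divByXMinus1-cong p≈q m = cong -_ (sumTo-cong m (λ i _ → p≈q i))

divByXMinus1-zero : divByXMinus1 0P ≈P 0P
divByXMinus1-zero m = cong -_ (sumTo-zero m (λ _ _ → refl))

divByXMinus1-ΣP : ∀ {n} (f : Fin n → Poly) → divByXMinus1 (ΣP f) ≈P ΣP (divByXMinus1 ∘ f)
divByXMinus1-ΣP = ΣP.homomorphic divByXMinus1 divByXMinus1-cong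
  (λ p q m → trans (cong -_ (sumTo-+ m p q)) (ℤ.neg-distrib-+ (sumTo m p) (sumTo m q)))
  divByXMinus1-zero

-- c x^e = c (x - 1)[e]ₓ + c, and divByXMinus1 sends the constant c to -c/(1 - x) = -c · ones.
divByXMinus1-monomial : ∀ c e → divByXMinus1 (c ·P xpow e) ≈P c ·P qInt e +P (- c) ·P ones
divByXMinus1-monomial c e m = begin
  - sumTo m (λ i → c * xpow e i)    ≡⟨ cong -_ (sumTo-*ˡ m c (xpow e)) ⟩
  - (c * sumTo m (xpow e))          ≡⟨ ring c (sumTo m (xpow e)) (qInt e m) (sumTo-xpow e m) ⟩
  c * qInt e m + - c * + 1          ∎
  where
  open ≡.≡-Reasoning
  ring : ∀ c s q → s + q ≡ + 1 → - (c * s) ≡ c * q + - c * + 1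
  ring c s q s+q≡1 = trans (identity c s q) (cong (λ z → c * q + - c * z) s+q≡1)
    where
    identity : ∀ c s q → - (c * s) ≡ c * q + - c * (s + q)
    identity = solve-∀

module _ {m : ℕ} where

  subset : {A : Fin m → Set} → (∀ z → Dec (A z)) → Subset m
  subset A? = tabulate (λ z → ⌊ A? z ⌋)

  ∈-subset⁺ : ∀ {A : Fin m → Set} (A? : ∀ z → Dec (A z)) → ∀ {z} → A z → z ∈ subset A?
  ∈-subset⁺ A? {z} a = lookup⇒[]= z (subset A?) (trans (lookup∘tabulate _ z) (Equivalence.to T-≡ (fromWitness a)))

  ∈-subset⁻ : ∀ {A : Fin m → Set} (A? : ∀ z → Dec (A z)) → ∀ {z} → z ∈ subset A? → A z
  ∈-subset⁻ A? {z} z∈ = toWitness (Equivalence.from T-≡ (trans (sym (lookup∘tabulate _ z)) ([]=⇒lookup z∈)))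

  ∣subset∣-pos : ∀ {A : Fin m → Set} (A? : ∀ z → Dec (A z)) → ∀ {x} → A x → 0 ℕ.< ∣ subset A? ∣
  ∣subset∣-pos A? {x} a = ℕ.<-≤-trans
    (ℕ.≤-reflexive (cong suc (sym (∣⊥∣≡0 m))))
    (p⊂q⇒∣p∣<∣q∣ (⊆-min (subset A?) , x , ∈-subset⁺ A? a , ∉⊥))

  ∣subset∣-< : ∀ {A B : Fin m → Set} (A? : ∀ z → Dec (A z)) (B? : ∀ z → Dec (B z)) → (∀ {z} → A z → B z) →
               ∀ {x} → B x → ¬ A x → ∣ subset A? ∣ ℕ.< ∣ subset B? ∣
  ∣subset∣-< A? B? A⊆B {x} b ¬a = p⊂q⇒∣p∣<∣q∣
    ((λ z∈ → ∈-subset⁺ B? (A⊆B (∈-subset⁻ A? z∈))) , x , ∈-subset⁺ B? b , ¬a ∘ ∈-subset⁻ A?)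

module _ (P : FinGradedBoundedPoset) where
  open FinGradedBoundedPoset P
  open IsPartialOrder isPartialOrder using (antisym) renaming (refl to ≤-refl; trans to ≤-trans)

  infix 4 _<_ _⋖_ _<?_

  _<_ : Fin n → Fin n → Set
  s < t = s ≤ t × s ≢ t

  _<?_ : ∀ s t → Dec (s < t)
  s <? t = (s ≤? t) ×-dec ¬? (s ≟ t)

  _⋖_ : Fin n → Fin n → Set
  _⋖_ = Covers _≤_

  ⋖⇒< : ∀ {s t} → s ⋖ t → s < t
  ⋖⇒< (s≤t , s≢t , _) = s≤t , s≢t

  ≤-<-trans : ∀ {s t u} → s ≤ t → t < u → s < u
  ≤-<-trans s≤t (t≤u , t≢u) = ≤-trans s≤t t≤u , λ { refl → t≢u (antisym t≤u s≤t) }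

  ¬⋖⇒between : ∀ {s t} → s < t → ¬ s ⋖ t → ∃ λ z → s < z × z < t
  ¬⋖⇒between {s} {t} (s≤t , s≢t) ¬s⋖t = between (¬∀⟶∃¬ n Between? Between-dec (λ all → ¬s⋖t (s≤t , s≢t , all)))
    where
    Between? : Fin n → Set
    Between? z = s ≤ z → z ≤ t → z ≡ s ⊎ z ≡ t
    Between-dec : ∀ z → Dec (Between? z)
    Between-dec z = (s ≤? z) →-dec ((z ≤? t) →-dec ((z ≟ s) ⊎-dec (z ≟ t)))
    between : ∃ (¬_ ∘ Between?) → ∃ λ z → s < z × z < t
    between (z , ¬between) with s ≤? z | z ≤? t | z ≟ s | z ≟ t
    ... | yes s≤z | yes z≤t | no z≢s | no z≢t = z , (s≤z , z≢s ∘ sym) , (z≤t , z≢t)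
    ... | no ¬s≤z | _       | _      | _      = contradiction (λ s≤z → contradiction s≤z ¬s≤z) ¬between
    ... | _       | no ¬z≤t | _      | _      = contradiction (λ _ z≤t → contradiction z≤t ¬z≤t) ¬between
    ... | _       | _       | yes z≡s | _     = contradiction (λ _ _ → inj₁ z≡s) ¬between
    ... | _       | _       | _      | yes z≡t = contradiction (λ _ _ → inj₂ z≡t) ¬between

  ρ-strictMono : ∀ {s t} → s < t → ρ s ℕ.< ρ t
  ρ-strictMono {s} {t} = downwards (po-wellFounded isPartialOrder t)
    where
    upwards : ∀ {t} → (∀ {z} → z < t → ∀ {s} → s < z → ρ s ℕ.< ρ z) →
              ∀ {s} → Acc (flip _<_) s → s < t → ρ s ℕ.< ρ t
    upwards {t} below {s} (acc above) s<t with covers? P s t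
    ... | yes s⋖t = ℕ.≤-reflexive (sym (ρ-cover s t s⋖t))
    ... | no ¬s⋖t with ¬⋖⇒between s<t ¬s⋖t
    ... | z , s<z , z<t = ℕ.<-trans (below z<t s<z) (upwards below (above s<z) z<t)
    downwards : ∀ {t} → Acc _<_ t → ∀ {s} → s < t → ρ s ℕ.< ρ t
    downwards (acc below) {s} = upwards (λ z<t → downwards (below z<t)) (po-noetherian isPartialOrder s)

  ≢𝟘⇒0<ρ : ∀ {t} → t ≢ 𝟘 → 0 ℕ.< ρ t
  ≢𝟘⇒0<ρ {t} t≢𝟘 = ℕ.≤-trans (ℕ.≤-reflexive (cong suc (sym ρ-𝟘))) (ρ-strictMono (𝟘-min t , t≢𝟘 ∘ sym))

  ρ≡0⇒≡𝟘 : ∀ {t} → ρ t ≡ 0 → t ≡ 𝟘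
  ρ≡0⇒≡𝟘 {t} ρt≡0 with t ≟ 𝟘
  ... | yes t≡𝟘 = t≡𝟘
  ... | no t≢𝟘  = contradiction ρt≡0 (ℕ.<⇒≢ (≢𝟘⇒0<ρ t≢𝟘) ∘ sym)

  ρ≡1+ρ⇒⋖ : ∀ {s t} → s ≤ t → ρ t ≡ suc (ρ s) → s ⋖ t
  ρ≡1+ρ⇒⋖ {s} {t} s≤t ρt≡1+ρs = s≤t , s≢t , onlyEnds
    where
    s≢t : s ≢ t
    s≢t refl = ℕ.1+n≢n (sym ρt≡1+ρs)
    onlyEnds : ∀ z → s ≤ z → z ≤ t → z ≡ s ⊎ z ≡ t
    onlyEnds z s≤z z≤t with z ≟ s | z ≟ t
    ... | yes z≡s | _       = inj₁ z≡s
    ... | no _    | yes z≡t = inj₂ z≡t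
    ... | no z≢s  | no z≢t  = contradiction
      (ℕ.<-≤-trans (ρ-strictMono (s≤z , z≢s ∘ sym)) (ℕ.≤-pred (subst (ρ z ℕ.<_) ρt≡1+ρs (ρ-strictMono (z≤t , z≢t)))))
      (ℕ.<-irrefl refl)

  interval-reflects : ∀ (S : Fin n → Bool) s t w →
                      Reflects (T (S w) × s ≤ w × w ≤ t) (S w ∧ ⌊ s ≤? w ⌋ ∧ ⌊ w ≤? t ⌋)
  interval-reflects S s t w = T-reflects (S w) ×-reflects ⌊⌋-reflects (s ≤? w) ×-reflects ⌊⌋-reflects (w ≤? t)

  interval∧-reflects : ∀ {b} {B : Set} (S : Fin n → Bool) s t w → Reflects B b →
                       Reflects (T (S w) × s ≤ w × w ≤ t × B) (S w ∧ ⌊ s ≤? w ⌋ ∧ ⌊ w ≤? t ⌋ ∧ b)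
  interval∧-reflects S s t w r =
    T-reflects (S w) ×-reflects ⌊⌋-reflects (s ≤? w) ×-reflects ⌊⌋-reflects (w ≤? t) ×-reflects r

  ≢-reflects : ∀ (w t : Fin n) → Reflects (w ≢ t) (not ⌊ w ≟ t ⌋)
  ≢-reflects w t = ¬-reflects (⌊⌋-reflects (w ≟ t))

  interval-∖ : ∀ S s t x w (c : ℤ) →
    [ not ⌊ w ≟ x ⌋ ]ℤ ([ S w ∧ ⌊ s ≤? w ⌋ ∧ ⌊ w ≤? t ⌋ ]ℤ c) ≡ [ S w ∧ ⌊ s ≤? w ⌋ ∧ ⌊ w ≤? t ⌋ ∧ not ⌊ w ≟ x ⌋ ]ℤ c
  interval-∖ S s t x w c = trans (Σℤ.indicator-∧ (not ⌊ w ≟ x ⌋) _ c) (Σℤ.indicator-cong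
    (≢-reflects w x ×-reflects interval-reflects S s t w) (interval∧-reflects S s t w (≢-reflects w x))
    (λ (w≢x , Sw , s≤w , w≤t) → Sw , s≤w , w≤t , w≢x) (λ (Sw , s≤w , w≤t , w≢x) → w≢x , Sw , s≤w , w≤t)
    (λ _ → refl))

  -- Defs evaluates μ and H with fuel n. The recursion for μ_st only calls μ_sw with w < t, that for H_st
  -- only H_wt with s < w, so ∣ ↓ t ∣ resp. ∣ ↑ s ∣ (at most n) is enough fuel.
  ↓_ ↑_ : Fin n → Subset n
  ↓ t = subset (_≤? t)
  ↑ s = subset (s ≤?_)

  ∣↓∣-< : ∀ {w t} → w < t → ∣ ↓ w ∣ ℕ.< ∣ ↓ t ∣
  ∣↓∣-< {w} {t} (w≤t , w≢t) = ∣subset∣-< (_≤? w) (_≤? t) (λ z≤w → ≤-trans z≤w w≤t) ≤-refl (λ t≤w → w≢t (antisym w≤t t≤w))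

  ∣↑∣-< : ∀ {s w} → s < w → ∣ ↑ w ∣ ℕ.< ∣ ↑ s ∣
  ∣↑∣-< {s} {w} (s≤w , s≢w) = ∣subset∣-< (w ≤?_) (s ≤?_) (≤-trans s≤w) ≤-refl (λ w≤s → s≢w (antisym s≤w w≤s))

  mobiusF-stable : ∀ S k {s t} → ∣ ↓ t ∣ ℕ.≤ k → mobiusF P S k s t ≡ mobiusF P S (suc k) s t
  mobiusF-stable S zero    {t = t} ∣↓t∣≤0 = contradiction ∣↓t∣≤0 (ℕ.<⇒≱ (∣subset∣-pos (_≤? t) ≤-refl))
  mobiusF-stable S (suc k) {s} {t} ∣↓t∣≤k =
    cong (λ Σ → if ⌊ s ≟ t ⌋ then + 1 else [ ⌊ s ≤? t ⌋ ]ℤ (- Σ))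
      (Σℤ.cong λ w → Σℤ.indicator-congʳ (interval∧-reflects S s t w (≢-reflects w t))
        λ (_ , _ , w<t) → mobiusF-stable S k {s} (ℕ.≤-pred (ℕ.<-≤-trans (∣↓∣-< w<t) ∣↓t∣≤k)))

  chowF-stable : ∀ S r k {s t} → ∣ ↑ s ∣ ℕ.≤ k → chowF P S r k s t ≈P chowF P S r (suc k) s t
  chowF-stable S r zero    {s} ∣↑s∣≤0 = contradiction ∣↑s∣≤0 (ℕ.<⇒≱ (∣subset∣-pos (s ≤?_) ≤-refl))
  chowF-stable S r (suc k) {s} {t} ∣↑s∣≤k with s ≟ t
  ... | yes _ = ≈P-refl
  ... | no _  = ΣP.cong λ w → ΣP.indicator-congʳ (interval∧-reflects S s t w (≢-reflects w s))
        λ (_ , s≤w , _ , w≢s) → *P-cong {charBar P S r s w} ≈P-refl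
          (chowF-stable S r k {t = t} (ℕ.≤-pred (ℕ.<-≤-trans (∣↑∣-< (s≤w , w≢s ∘ sym)) ∣↑s∣≤k)))

  mobius-refl : ∀ S s → mobius P S s s ≡ + 1
  mobius-refl S s = trans (mobiusF-stable S n (∣p∣≤n (↓ s))) (if-⌊⌋-yes (s ≟ s) refl)

  mobius-unfold : ∀ S {s t} → s < t →
    mobius P S s t ≡ - Σℤ (λ w → [ S w ∧ ⌊ s ≤? w ⌋ ∧ ⌊ w ≤? t ⌋ ∧ not ⌊ w ≟ t ⌋ ]ℤ (mobius P S s w))
  mobius-unfold S {s} {t} (s≤t , s≢t) =
    trans (mobiusF-stable S n (∣p∣≤n (↓ t))) (trans (if-⌊⌋-no (s ≟ t) s≢t) (if-⌊⌋-yes (s ≤? t) s≤t))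

  mobiusF-local : ∀ S S′ k {s t} → (∀ z → s ≤ z → z ≤ t → S z ≡ S′ z) → mobiusF P S k s t ≡ mobiusF P S′ k s t
  mobiusF-local S S′ zero    S≗S′ = refl
  mobiusF-local S S′ (suc k) {s} {t} S≗S′ =
    cong (λ Σ → if ⌊ s ≟ t ⌋ then + 1 else [ ⌊ s ≤? t ⌋ ]ℤ (- Σ))
      (Σℤ.cong λ w → Σℤ.indicator-cong
        (interval∧-reflects S s t w (≢-reflects w t)) (interval∧-reflects S′ s t w (≢-reflects w t))
        (λ (Sw , s≤w , w≤t , w≢t) → subst T (S≗S′ w s≤w w≤t) Sw , s≤w , w≤t , w≢t)
        (λ (S′w , s≤w , w≤t , w≢t) → subst T (sym (S≗S′ w s≤w w≤t)) S′w , s≤w , w≤t , w≢t)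
        (λ (_ , s≤w , w≤t , _) → mobiusF-local S S′ k (λ z s≤z z≤w → S≗S′ z s≤z (≤-trans z≤w w≤t))))

  mobius-local : ∀ S S′ {s t} → (∀ z → s ≤ z → z ≤ t → S z ≡ S′ z) → mobius P S s t ≡ mobius P S′ s t
  mobius-local S S′ = mobiusF-local S S′ n

  mobius-sum : ∀ S {s t} → T (S t) → s < t →
    Σℤ (λ w → [ S w ∧ ⌊ s ≤? w ⌋ ∧ ⌊ w ≤? t ⌋ ]ℤ (mobius P S s w)) ≡ + 0
  mobius-sum S {s} {t} St s<t@(s≤t , _) = begin
    Σℤ (λ w → [ S w ∧ ⌊ s ≤? w ⌋ ∧ ⌊ w ≤? t ⌋ ]ℤ (mobius P S s w))
      ≡⟨ Σℤ.split t _ ⟩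
    [ S t ∧ ⌊ s ≤? t ⌋ ∧ ⌊ t ≤? t ⌋ ]ℤ (mobius P S s t) +
    Σℤ (λ w → [ not ⌊ w ≟ t ⌋ ]ℤ ([ S w ∧ ⌊ s ≤? w ⌋ ∧ ⌊ w ≤? t ⌋ ]ℤ (mobius P S s w)))
      ≡⟨ cong₂ _+_ (Σℤ.indicator-true (interval-reflects S s t t) (St , s≤t , ≤-refl))
                   (Σℤ.cong (λ w → interval-∖ S s t t w (mobius P S s w))) ⟩
    mobius P S s t + Σ<t
      ≡⟨ cong (_+ Σ<t) (mobius-unfold S s<t) ⟩
    - Σ<t + Σ<t
      ≡⟨ ℤ.+-inverseˡ Σ<t ⟩
    + 0 ∎
    where
    open ≡.≡-Reasoning
    Σ<t : ℤ
    Σ<t = Σℤ (λ w → [ S w ∧ ⌊ s ≤? w ⌋ ∧ ⌊ w ≤? t ⌋ ∧ not ⌊ w ≟ t ⌋ ]ℤ (mobius P S s w))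

  -- χ̄_st = Σ_{s ≤ w < t} μ_sw [r_t - r_w]ₓ, since χ_st = Σ_w μ_sw x^(r_t - r_w) and Σ_w μ_sw = 0.
  charBar-expansion : ∀ S r {s t} → T (S t) → s < t →
    charBar P S r s t ≈P
    ΣP (λ w → [ S w ∧ ⌊ s ≤? w ⌋ ∧ ⌊ w ≤? t ⌋ ∧ not ⌊ w ≟ t ⌋ ]P (mobius P S s w ·P qInt (r t ∸ r w)))
  charBar-expansion S r {s} {t} St s<t@(_ , s≢t) = begin
    charBar P S r s t
      ≡⟨ if-⌊⌋-no (s ≟ t) s≢t ⟩
    divByXMinus1 (ΣP (λ w → [ g w ]P (μ w ·P xpow (e w))))
      ≈⟨ divByXMinus1-ΣP (λ w → [ g w ]P (μ w ·P xpow (e w))) ⟩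
    ΣP (λ w → divByXMinus1 ([ g w ]P (μ w ·P xpow (e w))))
      ≈⟨ ΣP.cong (λ w → ΣP.indicator-homomorphic divByXMinus1 divByXMinus1-zero (g w) _) ⟩
    ΣP (λ w → [ g w ]P (divByXMinus1 (μ w ·P xpow (e w))))
      ≈⟨ ΣP.cong (λ w → ΣP.indicator-congʳ (T-reflects (g w)) λ _ → divByXMinus1-monomial (μ w) (e w)) ⟩
    ΣP (λ w → [ g w ]P (μ w ·P qInt (e w) +P (- μ w) ·P ones))
      ≈⟨ ΣP.cong (λ w → ΣP.indicator-∙ (g w) _ _) ⟩
    ΣP (λ w → [ g w ]P (μ w ·P qInt (e w)) +P [ g w ]P ((- μ w) ·P ones))
      ≈⟨ ΣP.distrib (λ w → [ g w ]P (μ w ·P qInt (e w))) (λ w → [ g w ]P ((- μ w) ·P ones)) ⟩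
    ΣP (λ w → [ g w ]P (μ w ·P qInt (e w))) +P ΣP (λ w → [ g w ]P ((- μ w) ·P ones))
      ≈⟨ +P-cong (ΣP.cong (λ w → drop-top (w ≟ t))) constant-part-vanishes ⟩
    ΣP (λ w → [ g′ w ]P (μ w ·P qInt (e w))) +P 0P
      ≈⟨ +P-identityʳ _ ⟩
    ΣP (λ w → [ g′ w ]P (μ w ·P qInt (e w))) ∎
    where
    open ≈P-Reasoning
    g g′ : Fin n → Bool
    g  w = S w ∧ ⌊ s ≤? w ⌋ ∧ ⌊ w ≤? t ⌋
    g′ w = S w ∧ ⌊ s ≤? w ⌋ ∧ ⌊ w ≤? t ⌋ ∧ not ⌊ w ≟ t ⌋
    μ : Fin n → ℤ
    μ = mobius P S s
    e : Fin n → ℕ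
    e w = r t ∸ r w
    drop-top : ∀ {w} → Dec (w ≡ t) → [ g w ]P (μ w ·P qInt (e w)) ≈P [ g′ w ]P (μ w ·P qInt (e w))
    drop-top (yes refl) = ≈P-trans
      (ΣP.indicator-ε (g t) (λ i → trans (cong (λ k → μ t * qInt k i) (ℕ.n∸n≡0 (r t))) (ℤ.*-zeroʳ (μ t))))
      (≈P-sym (ΣP.indicator-false (interval∧-reflects S s t t (≢-reflects t t)) (λ (_ , _ , _ , t≢t) → t≢t refl)))
    drop-top {w} (no w≢t) = ΣP.indicator-cong (interval-reflects S s t w) (interval∧-reflects S s t w (≢-reflects w t))
      (λ (Sw , s≤w , w≤t) → Sw , s≤w , w≤t , w≢t) (λ (Sw , s≤w , w≤t , _) → Sw , s≤w , w≤t) (λ _ → ≈P-refl)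
    constant-part-vanishes : ΣP (λ w → [ g w ]P ((- μ w) ·P ones)) ≈P 0P
    constant-part-vanishes i = trans (ΣP-indicator-·P g (-_ ∘ μ) ones i)
      (cong (_* + 1) (trans (Σℤ-indicator-neg g μ) (cong -_ (mobius-sum S St s<t))))

  charBar-local : ∀ S S′ r r′ {s t} → (∀ z → s ≤ z → z ≤ t → S z ≡ S′ z) → (∀ z → s ≤ z → z ≤ t → r z ≡ r′ z) →
                  charBar P S r s t ≈P charBar P S′ r′ s t
  charBar-local S S′ r r′ {s} {t} S≗S′ r≗r′ with s ≟ t
  ... | yes _ = ≈P-refl
  ... | no _  = divByXMinus1-cong (ΣP.cong λ w → ΣP.indicator-cong
    (interval-reflects S s t w) (interval-reflects S′ s t w)
    (λ (Sw , s≤w , w≤t) → subst T (S≗S′ w s≤w w≤t) Sw , s≤w , w≤t)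
    (λ (S′w , s≤w , w≤t) → subst T (sym (S≗S′ w s≤w w≤t)) S′w , s≤w , w≤t)
    (λ (_ , s≤w , w≤t) i → cong₂ (λ m k → m * xpow k i)
      (mobius-local S S′ (λ z s≤z z≤w → S≗S′ z s≤z (≤-trans z≤w w≤t)))
      (cong₂ _∸_ (r≗r′ t (≤-trans s≤w w≤t) ≤-refl) (r≗r′ w s≤w w≤t))))

  chow-refl : ∀ S r s → chow P S r s s ≈P 1P
  chow-refl S r s = ≈P-trans (chowF-stable S r n (∣p∣≤n (↑ s))) (≈P-reflexive (if-⌊⌋-yes (s ≟ s) refl))

  chow-unfold : ∀ S r {s t} → s ≢ t →
    chow P S r s t ≈P ΣP (λ w → [ S w ∧ ⌊ s ≤? w ⌋ ∧ ⌊ w ≤? t ⌋ ∧ not ⌊ w ≟ s ⌋ ]P (charBar P S r s w *P chow P S r w t))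
  chow-unfold S r {s} {t} s≢t = ≈P-trans (chowF-stable S r n (∣p∣≤n (↑ s))) (≈P-reflexive (if-⌊⌋-no (s ≟ t) s≢t))

  -- Truncated intervals

  infix 4 _<₂_ _<₂?_

  -- ρ_st ≥ 2
  _<₂_ : Fin n → Fin n → Set
  s <₂ t = s < t × ¬ s ⋖ t

  _<₂?_ : ∀ s t → Dec (s <₂ t)
  s <₂? t = (s <? t) ×-dec ¬? (covers? P s t)

  μ : Fin n → Fin n → ℤ
  μ = mobius P (everything P)

  χ̄ : Fin n → Fin n → Poly
  χ̄ = charBar P (everything P) ρ

  H : Fin n → Fin n → Poly
  H = chow P (everything P) ρ

  -- χ̄ and H of trunc([0̂,t]); from s ≤ t they only see trunc([s,t]).
  χ̄trunc : Fin n → Fin n → Fin n → Poly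
  χ̄trunc t = charBar P (trunc P t) (truncRank P t)

  Htrunc : Fin n → Fin n → Poly
  Htrunc s t = chow P (trunc P t) (truncRank P t) s t

  trunc-reflects : ∀ t w → Reflects (w ≤ t × ¬ w ⋖ t) (trunc P t w)
  trunc-reflects t w = ⌊⌋-reflects (w ≤? t) ×-reflects ¬-reflects (⌊⌋-reflects (covers? P w t))

  trunc-below : ∀ {z w t} → z ≤ w → w <₂ t → trunc P t z ≡ true
  trunc-below {z} {w} {t} z≤w ((w≤t , w≢t) , ¬w⋖t) = det (trunc-reflects t z) (ofʸ (≤-trans z≤w w≤t , ¬z⋖t))
    where
    ¬z⋖t : ¬ z ⋖ t
    ¬z⋖t z⋖t@(_ , _ , onlyEnds) with onlyEnds w z≤w w≤t
    ... | inj₁ refl = ¬w⋖t z⋖t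
    ... | inj₂ w≡t  = w≢t w≡t

  truncRank-below : ∀ {w t} → w ≢ t → truncRank P t w ≡ ρ w
  truncRank-below {w} {t} = if-⌊⌋-no (w ≟ t)

  truncRank-∸ : ∀ {w t} → w ≢ t → truncRank P t t ∸ truncRank P t w ≡ ρ t ∸ ρ w ∸ 1
  truncRank-∸ {w} {t} w≢t = begin
    truncRank P t t ∸ truncRank P t w ≡⟨ cong₂ _∸_ (if-⌊⌋-yes (t ≟ t) refl) (truncRank-below w≢t) ⟩
    ρ t ∸ 1 ∸ ρ w                     ≡⟨ ℕ.∸-+-assoc (ρ t) 1 (ρ w) ⟩
    ρ t ∸ (1 ℕ.+ ρ w)                 ≡⟨ cong (ρ t ∸_) (ℕ.+-comm 1 (ρ w)) ⟩
    ρ t ∸ (ρ w ℕ.+ 1)                 ≡⟨ ℕ.∸-+-assoc (ρ t) (ρ w) 1 ⟨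
    ρ t ∸ ρ w ∸ 1                     ∎
    where open ≡.≡-Reasoning

  χ̄trunc-below : ∀ {s w t} → w <₂ t → χ̄trunc t s w ≈P χ̄ s w
  χ̄trunc-below {s} {t = t} w<₂t@((w≤t , w≢t) , _) = charBar-local (trunc P t) (everything P) (truncRank P t) ρ {s}
    (λ z _ z≤w → trunc-below z≤w w<₂t)
    (λ z _ z≤w → truncRank-below λ { refl → w≢t (antisym w≤t z≤w) })

  ⋖-onlyEnds : ∀ {s t w} → s ⋖ t → w ≢ s → ¬ (s ≤ w × w ≤ t × w ≢ t)
  ⋖-onlyEnds (_ , _ , onlyEnds) w≢s (s≤w , w≤t , w≢t) with onlyEnds _ s≤w w≤t
  ... | inj₁ w≡s = w≢s w≡s
  ... | inj₂ w≡t = w≢t w≡t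

  μ-⋖ : ∀ {s t} → s ⋖ t → μ s t ≡ - + 1
  μ-⋖ {s} {t} s⋖t = trans (mobius-unfold (everything P) (⋖⇒< s⋖t)) (cong -_ (begin
    Σℤ (λ w → [ ⌊ s ≤? w ⌋ ∧ ⌊ w ≤? t ⌋ ∧ not ⌊ w ≟ t ⌋ ]ℤ (μ s w))
      ≡⟨ Σℤ.concentrated s (λ w w≢s → Σℤ.indicator-false (interval∧-reflects (everything P) s t w (≢-reflects w t))
                                         (λ (_ , rest) → ⋖-onlyEnds s⋖t w≢s rest)) ⟩
    [ ⌊ s ≤? s ⌋ ∧ ⌊ s ≤? t ⌋ ∧ not ⌊ s ≟ t ⌋ ]ℤ (μ s s)
      ≡⟨ Σℤ.indicator-true (interval∧-reflects (everything P) s t s (≢-reflects s t)) (_ , ≤-refl , ⋖⇒< s⋖t) ⟩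
    μ s s
      ≡⟨ mobius-refl (everything P) s ⟩
    + 1 ∎))
    where open ≡.≡-Reasoning

  qInt-1 : qInt 1 ≈P 1P
  qInt-1 zero    = refl
  qInt-1 (suc m) = refl

  ρ-⋖ : ∀ {s t} → s ⋖ t → ρ t ∸ ρ s ≡ 1
  ρ-⋖ {s} {t} s⋖t = trans (cong (_∸ ρ s) (ρ-cover s t s⋖t)) (ℕ.m+n∸n≡m 1 (ρ s))

  χ̄-⋖ : ∀ {s t} → s ⋖ t → χ̄ s t ≈P 1P
  χ̄-⋖ {s} {t} s⋖t = begin
    χ̄ s t
      ≈⟨ charBar-expansion (everything P) ρ _ (⋖⇒< s⋖t) ⟩
    ΣP (λ w → [ ⌊ s ≤? w ⌋ ∧ ⌊ w ≤? t ⌋ ∧ not ⌊ w ≟ t ⌋ ]P (μ s w ·P qInt (ρ t ∸ ρ w)))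
      ≈⟨ ΣP.concentrated s (λ w w≢s → ΣP.indicator-false (interval∧-reflects (everything P) s t w (≢-reflects w t))
                                         (λ (_ , rest) → ⋖-onlyEnds s⋖t w≢s rest)) ⟩
    [ ⌊ s ≤? s ⌋ ∧ ⌊ s ≤? t ⌋ ∧ not ⌊ s ≟ t ⌋ ]P (μ s s ·P qInt (ρ t ∸ ρ s))
      ≈⟨ ΣP.indicator-true (interval∧-reflects (everything P) s t s (≢-reflects s t)) (_ , ≤-refl , ⋖⇒< s⋖t) ⟩
    μ s s ·P qInt (ρ t ∸ ρ s)
      ≈⟨ (λ i → cong₂ (λ m e → m * qInt e i) (mobius-refl (everything P) s) (ρ-⋖ s⋖t)) ⟩
    + 1 ·P qInt 1
      ≈⟨ (λ i → trans (ℤ.*-identityˡ (qInt 1 i)) (qInt-1 i)) ⟩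
    1P ∎
    where open ≈P-Reasoning

  module _ {s t : Fin n} where
    private
      g gᵗ : Fin n → Bool
      g  w = ⌊ s ≤? w ⌋ ∧ ⌊ w ≤? t ⌋ ∧ not ⌊ w ≟ t ⌋
      gᵗ w = trunc P t w ∧ g w
      g-reflects : ∀ w → Reflects (⊤ × s ≤ w × w ≤ t × w ≢ t) (g w)
      g-reflects w = interval∧-reflects (everything P) s t w (≢-reflects w t)
      gᵗ-reflects : ∀ w → Reflects ((w ≤ t × ¬ w ⋖ t) × s ≤ w × w ≤ t × w ≢ t) (gᵗ w)
      gᵗ-reflects w = trunc-reflects t w ×-reflects ⌊⌋-reflects (s ≤? w) ×-reflects ⌊⌋-reflects (w ≤? t) ×-reflects ≢-reflects w t
      summandᵗ : Fin n → Poly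
      summandᵗ w = mobius P (trunc P t) s w ·P qInt (truncRank P t t ∸ truncRank P t w)

      -- In trunc([0̂,t]) the coatoms w of [s,t] are missing and the rank difference of the others drops by one.
      peel : ∀ w → [ g w ]P (μ s w ·P qInt (ρ t ∸ ρ w)) ≈P [ g w ]P (μ s w ·P 1P) +P shift ([ gᵗ w ]P (summandᵗ w))
      peel w with (s ≤? w) ×-dec (w ≤? t) ×-dec ¬? (w ≟ t)
      ... | no ¬s≤w<t = begin
        [ g w ]P (μ s w ·P qInt (ρ t ∸ ρ w))  ≈⟨ ΣP.indicator-false (g-reflects w) (¬s≤w<t ∘ proj₂) ⟩
        0P                                     ≈⟨ +P-identityʳ 0P ⟨
        0P +P 0P                               ≈⟨ +P-cong (ΣP.indicator-false (g-reflects w) (¬s≤w<t ∘ proj₂))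
                                                    (≈P-trans (shift-cong (ΣP.indicator-false (gᵗ-reflects w) (¬s≤w<t ∘ proj₂)))
                                                              shift-zero) ⟨
        [ g w ]P (μ s w ·P 1P) +P shift ([ gᵗ w ]P (summandᵗ w)) ∎
        where open ≈P-Reasoning
      ... | yes (s≤w , w≤t , w≢t) = begin
        [ g w ]P (μ s w ·P qInt (ρ t ∸ ρ w))
          ≈⟨ ΣP.indicator-true (g-reflects w) (_ , s≤w , w≤t , w≢t) ⟩
        μ s w ·P qInt (ρ t ∸ ρ w)
          ≈⟨ qInt-peel (μ s w) (ℕ.m<n⇒0<n∸m (ρ-strictMono (w≤t , w≢t))) ⟩
        μ s w ·P 1P +P shift (μ s w ·P qInt (ρ t ∸ ρ w ∸ 1))
          ≈⟨ +P-cong (≈P-sym (ΣP.indicator-true (g-reflects w) (_ , s≤w , w≤t , w≢t))) (shift-cong (remainder (covers? P w t))) ⟩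
        [ g w ]P (μ s w ·P 1P) +P shift ([ gᵗ w ]P (summandᵗ w)) ∎
        where
        open ≈P-Reasoning
        remainder : Dec (w ⋖ t) → μ s w ·P qInt (ρ t ∸ ρ w ∸ 1) ≈P [ gᵗ w ]P (summandᵗ w)
        remainder (yes w⋖t) = ≈P-trans
          (λ i → trans (cong (λ e → μ s w * qInt (e ∸ 1) i) (ρ-⋖ w⋖t)) (ℤ.*-zeroʳ (μ s w)))
          (≈P-sym (ΣP.indicator-false (gᵗ-reflects w) λ ((_ , ¬w⋖t) , _) → ¬w⋖t w⋖t))
        remainder (no ¬w⋖t) = ≈P-sym (≈P-trans (ΣP.indicator-true (gᵗ-reflects w) ((w≤t , ¬w⋖t) , s≤w , w≤t , w≢t))
          (λ i → cong₂ (λ m e → m * qInt e i)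
            (mobius-local (trunc P t) (everything P) (λ z _ z≤w → trunc-below z≤w ((w≤t , w≢t) , ¬w⋖t)))
            (truncRank-∸ w≢t)))

    χ̄trunc-top : s <₂ t → shift (χ̄trunc t s t) ≈P χ̄ s t +P μ s t ·P 1P
    χ̄trunc-top (s<t , _) i = solve-for (shift (χ̄trunc t s t) i) {m = μ s t} {o = 1P i} (expanded i)
      where
      open ≈P-Reasoning
      t∈trunc : T (trunc P t t)
      t∈trunc = T-intro (trunc-reflects t t) (≤-refl , λ (_ , t≢t , _) → t≢t refl)
      expanded : χ̄ s t ≈P (- μ s t) ·P 1P +P shift (χ̄trunc t s t)
      expanded = begin
        χ̄ s t
          ≈⟨ charBar-expansion (everything P) ρ _ s<t ⟩
        ΣP (λ w → [ g w ]P (μ s w ·P qInt (ρ t ∸ ρ w)))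
          ≈⟨ ΣP.cong peel ⟩
        ΣP (λ w → [ g w ]P (μ s w ·P 1P) +P shift ([ gᵗ w ]P (summandᵗ w)))
          ≈⟨ ΣP.distrib (λ w → [ g w ]P (μ s w ·P 1P)) (λ w → shift ([ gᵗ w ]P (summandᵗ w))) ⟩
        ΣP (λ w → [ g w ]P (μ s w ·P 1P)) +P ΣP (λ w → shift ([ gᵗ w ]P (summandᵗ w)))
          ≈⟨ +P-cong (ΣP-indicator-·P g (μ s) 1P) (≈P-sym (shift-ΣP (λ w → [ gᵗ w ]P (summandᵗ w)))) ⟩
        Σℤ (λ w → [ g w ]ℤ (μ s w)) ·P 1P +P shift (ΣP (λ w → [ gᵗ w ]P (summandᵗ w)))
          ≈⟨ +P-cong (λ i → cong (_* 1P i) (trans (sym (ℤ.neg-involutive _)) (cong -_ (sym (mobius-unfold (everything P) s<t)))))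
                     (shift-cong (≈P-sym (charBar-expansion (trunc P t) (truncRank P t) t∈trunc s<t))) ⟩
        (- μ s t) ·P 1P +P shift (χ̄trunc t s t) ∎
      solve-for : ∀ y {x m o} → x ≡ - m * o + y → y ≡ x + m * o
      solve-for y {x} {m} {o} refl = identity y m o
        where
        identity : ∀ y m o → y ≡ - m * o + y + m * o
        identity = solve-∀

  Htrunc-unfold : ∀ {s t} → s <₂ t →
    shift (Htrunc s t) ≈P
    (χ̄ s t +P μ s t ·P 1P) +P shift (ΣP (λ w → [ ⌊ s <? w ⌋ ∧ ⌊ w <₂? t ⌋ ]P (χ̄ s w *P Htrunc w t)))
  Htrunc-unfold {s} {t} s<₂t@((s≤t , s≢t) , _) = begin
    shift (Htrunc s t)
      ≈⟨ shift-cong (chow-unfold (trunc P t) (truncRank P t) s≢t) ⟩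
    shift (ΣP (λ w → [ g w ]P (χ̄trunc t s w *P Htrunc w t)))
      ≈⟨ shift-cong (ΣP.split t (λ w → [ g w ]P (χ̄trunc t s w *P Htrunc w t))) ⟩
    shift ([ g t ]P (χ̄trunc t s t *P Htrunc t t) +P
           ΣP (λ w → [ not ⌊ w ≟ t ⌋ ]P ([ g w ]P (χ̄trunc t s w *P Htrunc w t))))
      ≈⟨ shift-cong (+P-cong top-summand (ΣP.cong other-summands)) ⟩
    shift (χ̄trunc t s t +P ΣP (λ w → [ ⌊ s <? w ⌋ ∧ ⌊ w <₂? t ⌋ ]P (χ̄ s w *P Htrunc w t)))
      ≈⟨ shift-+ (χ̄trunc t s t) _ ⟩
    shift (χ̄trunc t s t) +P shift (ΣP (λ w → [ ⌊ s <? w ⌋ ∧ ⌊ w <₂? t ⌋ ]P (χ̄ s w *P Htrunc w t)))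
      ≈⟨ +P-congʳ (χ̄trunc-top s<₂t) ⟩
    (χ̄ s t +P μ s t ·P 1P) +P shift (ΣP (λ w → [ ⌊ s <? w ⌋ ∧ ⌊ w <₂? t ⌋ ]P (χ̄ s w *P Htrunc w t))) ∎
    where
    open ≈P-Reasoning
    g : Fin n → Bool
    g w = trunc P t w ∧ ⌊ s ≤? w ⌋ ∧ ⌊ w ≤? t ⌋ ∧ not ⌊ w ≟ s ⌋
    g-reflects : ∀ w → Reflects ((w ≤ t × ¬ w ⋖ t) × s ≤ w × w ≤ t × w ≢ s) (g w)
    g-reflects w = trunc-reflects t w ×-reflects ⌊⌋-reflects (s ≤? w) ×-reflects ⌊⌋-reflects (w ≤? t) ×-reflects ≢-reflects w s
    top-summand : [ g t ]P (χ̄trunc t s t *P Htrunc t t) ≈P χ̄trunc t s t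
    top-summand = begin
      [ g t ]P (χ̄trunc t s t *P Htrunc t t)
        ≈⟨ ΣP.indicator-true (g-reflects t) ((≤-refl , λ (_ , t≢t , _) → t≢t refl) , s≤t , ≤-refl , s≢t ∘ sym) ⟩
      χ̄trunc t s t *P Htrunc t t
        ≈⟨ *P-cong {χ̄trunc t s t} ≈P-refl (chow-refl (trunc P t) (truncRank P t) t) ⟩
      χ̄trunc t s t *P 1P
        ≈⟨ *P-identityʳ (χ̄trunc t s t) ⟩
      χ̄trunc t s t ∎
    other-summands : ∀ w → [ not ⌊ w ≟ t ⌋ ]P ([ g w ]P (χ̄trunc t s w *P Htrunc w t)) ≈P
                           [ ⌊ s <? w ⌋ ∧ ⌊ w <₂? t ⌋ ]P (χ̄ s w *P Htrunc w t)
    other-summands w = ≈P-trans (≈P-reflexive (ΣP.indicator-∧ (not ⌊ w ≟ t ⌋) (g w) _)) (ΣP.indicator-cong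
      (≢-reflects w t ×-reflects g-reflects w) (⌊⌋-reflects (s <? w) ×-reflects ⌊⌋-reflects (w <₂? t))
      (λ (w≢t , (w≤t , ¬w⋖t) , s≤w , _ , w≢s) → (s≤w , w≢s ∘ sym) , (w≤t , w≢t) , ¬w⋖t)
      (λ ((s≤w , s≢w) , (w≤t , w≢t) , ¬w⋖t) → w≢t , (w≤t , ¬w⋖t) , s≤w , w≤t , s≢w ∘ sym)
      (λ (w≢t , (w≤t , ¬w⋖t) , _) → *P-cong {q = Htrunc w t} (χ̄trunc-below {s} ((w≤t , w≢t) , ¬w⋖t)) ≈P-refl))

  mobius-sum-above : ∀ {s u} → s < u → Σℤ (λ w → [ ⌊ s ≤? w ⌋ ∧ ⌊ w ≤? u ⌋ ∧ not ⌊ w ≟ s ⌋ ]ℤ (μ s w)) ≡ - + 1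
  mobius-sum-above {s} {u} s<u@(s≤u , _) = trans (solve-for Σ>s) (cong (_+ - + 1) 1+Σ>s≡0)
    where
    Σ>s : ℤ
    Σ>s = Σℤ (λ w → [ ⌊ s ≤? w ⌋ ∧ ⌊ w ≤? u ⌋ ∧ not ⌊ w ≟ s ⌋ ]ℤ (μ s w))
    1+Σ>s≡0 : + 1 + Σ>s ≡ + 0
    1+Σ>s≡0 = begin
      + 1 + Σ>s
        ≡⟨ cong₂ _+_ (trans (Σℤ.indicator-true (interval-reflects (everything P) s u s) (_ , ≤-refl , s≤u))
                            (mobius-refl (everything P) s))
                     (Σℤ.cong (λ w → interval-∖ (everything P) s u s w (μ s w))) ⟨
      [ ⌊ s ≤? s ⌋ ∧ ⌊ s ≤? u ⌋ ]ℤ (μ s s) + Σℤ (λ w → [ not ⌊ w ≟ s ⌋ ]ℤ ([ ⌊ s ≤? w ⌋ ∧ ⌊ w ≤? u ⌋ ]ℤ (μ s w)))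
        ≡⟨ Σℤ.split s (λ w → [ ⌊ s ≤? w ⌋ ∧ ⌊ w ≤? u ⌋ ]ℤ (μ s w)) ⟨
      Σℤ (λ w → [ ⌊ s ≤? w ⌋ ∧ ⌊ w ≤? u ⌋ ]ℤ (μ s w))
        ≡⟨ mobius-sum (everything P) _ s<u ⟩
      + 0 ∎
      where open ≡.≡-Reasoning
    solve-for : ∀ x → x ≡ + 1 + x + - + 1
    solve-for = solve-∀

  module _ {s u : Fin n} where
    open ≈P-Reasoning

    private
      g g₂ : Fin n → Bool
      g  w = ⌊ s ≤? w ⌋ ∧ ⌊ w ≤? u ⌋ ∧ not ⌊ w ≟ s ⌋
      g₂ w = ⌊ s <₂? w ⌋ ∧ ⌊ w ≤? u ⌋
      g-reflects : ∀ w → Reflects (⊤ × s ≤ w × w ≤ u × w ≢ s) (g w)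
      g-reflects w = interval∧-reflects (everything P) s u w (≢-reflects w s)
      g₂-reflects : ∀ w → Reflects (s <₂ w × w ≤ u) (g₂ w)
      g₂-reflects w = ⌊⌋-reflects (s <₂? w) ×-reflects ⌊⌋-reflects (w ≤? u)

      -- Over a cover χ̄ = 1 = -μ, so a cover only contributes its -μ.
      split-summand : ∀ w → Dec (s ≤ w × w ≤ u × w ≢ s) →
        [ g w ]P (χ̄ s w) ≈P [ g₂ w ]P (χ̄ s w +P μ s w ·P 1P) +P [ g w ]P ((- μ s w) ·P 1P)
      split-summand w (no ¬gw) = begin
        [ g w ]P (χ̄ s w)  ≈⟨ ΣP.indicator-false (g-reflects w) (¬gw ∘ proj₂) ⟩
        0P                 ≈⟨ +P-identityʳ 0P ⟨
        0P +P 0P           ≈⟨ +P-cong (ΣP.indicator-false (g₂-reflects w) λ (((s≤w , s≢w) , _) , w≤u) → ¬gw (s≤w , w≤u , s≢w ∘ sym))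
                                      (ΣP.indicator-false (g-reflects w) (¬gw ∘ proj₂)) ⟨
        [ g₂ w ]P (χ̄ s w +P μ s w ·P 1P) +P [ g w ]P ((- μ s w) ·P 1P) ∎
      split-summand w (yes (s≤w , w≤u , w≢s)) = interior (covers? P s w)
        where
        interior : Dec (s ⋖ w) →
          [ g w ]P (χ̄ s w) ≈P [ g₂ w ]P (χ̄ s w +P μ s w ·P 1P) +P [ g w ]P ((- μ s w) ·P 1P)
        interior (yes s⋖w) = begin
          [ g w ]P (χ̄ s w)           ≈⟨ ΣP.indicator-true (g-reflects w) (_ , s≤w , w≤u , w≢s) ⟩
          χ̄ s w                      ≈⟨ χ̄-⋖ s⋖w ⟩
          1P                         ≈⟨ (λ i → trans (cong (_* 1P i) (cong -_ (μ-⋖ s⋖w))) (ℤ.*-identityˡ (1P i))) ⟨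
          (- μ s w) ·P 1P            ≈⟨ +P-identityˡ _ ⟨
          0P +P (- μ s w) ·P 1P      ≈⟨ +P-cong (ΣP.indicator-false (g₂-reflects w) λ ((_ , ¬s⋖w) , _) → ¬s⋖w s⋖w)
                                                (ΣP.indicator-true (g-reflects w) (_ , s≤w , w≤u , w≢s)) ⟨
          [ g₂ w ]P (χ̄ s w +P μ s w ·P 1P) +P [ g w ]P ((- μ s w) ·P 1P) ∎
        interior (no ¬s⋖w) = begin
          [ g w ]P (χ̄ s w)           ≈⟨ ΣP.indicator-true (g-reflects w) (_ , s≤w , w≤u , w≢s) ⟩
          χ̄ s w                      ≈⟨ (λ i → cancel (χ̄ s w i) (μ s w) (1P i)) ⟩
          (χ̄ s w +P μ s w ·P 1P) +P (- μ s w) ·P 1P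
            ≈⟨ +P-cong (ΣP.indicator-true (g₂-reflects w) (((s≤w , w≢s ∘ sym) , ¬s⋖w) , w≤u))
                       (ΣP.indicator-true (g-reflects w) (_ , s≤w , w≤u , w≢s)) ⟨
          [ g₂ w ]P (χ̄ s w +P μ s w ·P 1P) +P [ g w ]P ((- μ s w) ·P 1P) ∎
          where
          cancel : ∀ x m o → x ≡ x + m * o + - m * o
          cancel = solve-∀
    χ̄-row-sum : s < u →
      ΣP (λ w → [ g w ]P (χ̄ s w)) ≈P 1P +P ΣP (λ t → [ g₂ t ]P (χ̄ s t +P μ s t ·P 1P))
    χ̄-row-sum s<u = begin
      ΣP (λ w → [ g w ]P (χ̄ s w))
        ≈⟨ ΣP.cong (λ w → split-summand w ((s ≤? w) ×-dec (w ≤? u) ×-dec ¬? (w ≟ s))) ⟩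
      ΣP (λ w → [ g₂ w ]P (χ̄ s w +P μ s w ·P 1P) +P [ g w ]P ((- μ s w) ·P 1P))
        ≈⟨ ΣP.distrib (λ w → [ g₂ w ]P (χ̄ s w +P μ s w ·P 1P)) (λ w → [ g w ]P ((- μ s w) ·P 1P)) ⟩
      ΣP (λ w → [ g₂ w ]P (χ̄ s w +P μ s w ·P 1P)) +P ΣP (λ w → [ g w ]P ((- μ s w) ·P 1P))
        ≈⟨ +P-comm (ΣP (λ w → [ g₂ w ]P (χ̄ s w +P μ s w ·P 1P))) (ΣP (λ w → [ g w ]P ((- μ s w) ·P 1P))) ⟩
      ΣP (λ w → [ g w ]P ((- μ s w) ·P 1P)) +P ΣP (λ w → [ g₂ w ]P (χ̄ s w +P μ s w ·P 1P))
        ≈⟨ +P-congʳ one ⟩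
      1P +P ΣP (λ w → [ g₂ w ]P (χ̄ s w +P μ s w ·P 1P)) ∎
      where
      one : ΣP (λ w → [ g w ]P ((- μ s w) ·P 1P)) ≈P 1P
      one i = trans (ΣP-indicator-·P g (-_ ∘ μ s) 1P i)
        (trans (cong (_* 1P i) (trans (Σℤ-indicator-neg g (μ s)) (cong -_ (mobius-sum-above s<u))))
               (ℤ.*-identityˡ (1P i)))

  -- The χ-Chow polynomial

  ΣHtrunc : Fin n → Fin n → Poly
  ΣHtrunc s u = ΣP (λ t → [ ⌊ s <₂? t ⌋ ∧ ⌊ t ≤? u ⌋ ]P (Htrunc s t))

  ΣHtrunc-unfold : ∀ s u →
    shift (ΣHtrunc s u) ≈P
    ΣP (λ t → [ ⌊ s <₂? t ⌋ ∧ ⌊ t ≤? u ⌋ ]P (χ̄ s t +P μ s t ·P 1P)) +P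
    shift (ΣP (λ t → [ ⌊ s <₂? t ⌋ ∧ ⌊ t ≤? u ⌋ ]P (ΣP (λ w → [ ⌊ s <? w ⌋ ∧ ⌊ w <₂? t ⌋ ]P (χ̄ s w *P Htrunc w t)))))
  ΣHtrunc-unfold s u = begin
    shift (ΣP (λ t → [ L t ]P (Htrunc s t)))
      ≈⟨ shift-ΣP (λ t → [ L t ]P (Htrunc s t)) ⟩
    ΣP (λ t → shift ([ L t ]P (Htrunc s t)))
      ≈⟨ ΣP.cong (λ t → ≈P-trans (ΣP.indicator-homomorphic shift shift-zero (L t) (Htrunc s t))
                                  (ΣP.indicator-congʳ (L-reflects t) (Htrunc-unfold ∘ proj₁))) ⟩
    ΣP (λ t → [ L t ]P (c t +P shift (D t)))
      ≈⟨ ΣP.cong (λ t → ≈P-trans (ΣP.indicator-∙ (L t) (c t) (shift (D t)))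
                                  (+P-congˡ {[ L t ]P (c t)} (≈P-sym (ΣP.indicator-homomorphic shift shift-zero (L t) (D t))))) ⟩
    ΣP (λ t → [ L t ]P (c t) +P shift ([ L t ]P (D t)))
      ≈⟨ ΣP.distrib (λ t → [ L t ]P (c t)) (λ t → shift ([ L t ]P (D t))) ⟩
    ΣP (λ t → [ L t ]P (c t)) +P ΣP (λ t → shift ([ L t ]P (D t)))
      ≈⟨ +P-congˡ {ΣP (λ t → [ L t ]P (c t))} (shift-ΣP (λ t → [ L t ]P (D t))) ⟨
    ΣP (λ t → [ L t ]P (c t)) +P shift (ΣP (λ t → [ L t ]P (D t))) ∎
    where
    open ≈P-Reasoning
    L : Fin n → Bool
    L t = ⌊ s <₂? t ⌋ ∧ ⌊ t ≤? u ⌋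
    L-reflects : ∀ t → Reflects (s <₂ t × t ≤ u) (L t)
    L-reflects t = ⌊⌋-reflects (s <₂? t) ×-reflects ⌊⌋-reflects (t ≤? u)
    c D : Fin n → Poly
    c t = χ̄ s t +P μ s t ·P 1P
    D t = ΣP (λ w → [ ⌊ s <? w ⌋ ∧ ⌊ w <₂? t ⌋ ]P (χ̄ s w *P Htrunc w t))

  chain-reindex : ∀ s u (F : Fin n → Fin n → Poly) →
    ΣP (λ w → ΣP (λ t → [ (⌊ s ≤? w ⌋ ∧ ⌊ w ≤? u ⌋ ∧ not ⌊ w ≟ s ⌋) ∧ ⌊ w <₂? t ⌋ ∧ ⌊ t ≤? u ⌋ ]P (F w t))) ≈P
    ΣP (λ t → [ ⌊ s <₂? t ⌋ ∧ ⌊ t ≤? u ⌋ ]P (ΣP (λ w → [ ⌊ s <? w ⌋ ∧ ⌊ w <₂? t ⌋ ]P (F w t))))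
  chain-reindex s u F = ≈P-trans (ΣP.comm (λ w t → [ A w t ]P (F w t))) (ΣP.cong λ t → ≈P-trans
    (ΣP.cong λ w → ≈P-trans (ΣP.indicator-cong (A-reflects w t) (B-reflects t ×-reflects C-reflects w t) A⇒B×C B×C⇒A (λ _ → ≈P-refl))
                            (≈P-reflexive (sym (ΣP.indicator-∧ (B t) (C w t) (F w t)))))
    (≈P-sym (ΣP.indicator-Σ (B t) (λ w → [ C w t ]P (F w t)))))
    where
    A : Fin n → Fin n → Bool
    A w t = (⌊ s ≤? w ⌋ ∧ ⌊ w ≤? u ⌋ ∧ not ⌊ w ≟ s ⌋) ∧ ⌊ w <₂? t ⌋ ∧ ⌊ t ≤? u ⌋
    B : Fin n → Bool
    B t = ⌊ s <₂? t ⌋ ∧ ⌊ t ≤? u ⌋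
    C : Fin n → Fin n → Bool
    C w t = ⌊ s <? w ⌋ ∧ ⌊ w <₂? t ⌋
    A-reflects : ∀ w t → Reflects ((s ≤ w × w ≤ u × w ≢ s) × w <₂ t × t ≤ u) (A w t)
    A-reflects w t = (⌊⌋-reflects (s ≤? w) ×-reflects ⌊⌋-reflects (w ≤? u) ×-reflects ≢-reflects w s)
                     ×-reflects ⌊⌋-reflects (w <₂? t) ×-reflects ⌊⌋-reflects (t ≤? u)
    B-reflects : ∀ t → Reflects (s <₂ t × t ≤ u) (B t)
    B-reflects t = ⌊⌋-reflects (s <₂? t) ×-reflects ⌊⌋-reflects (t ≤? u)
    C-reflects : ∀ w t → Reflects (s < w × w <₂ t) (C w t)
    C-reflects w t = ⌊⌋-reflects (s <? w) ×-reflects ⌊⌋-reflects (w <₂? t)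
    A⇒B×C : ∀ {w t} → (s ≤ w × w ≤ u × w ≢ s) × w <₂ t × t ≤ u → (s <₂ t × t ≤ u) × (s < w × w <₂ t)
    A⇒B×C ((s≤w , _ , w≢s) , w<₂t@((w≤t , w≢t) , _) , t≤u) =
      ((≤-<-trans s≤w (w≤t , w≢t) , λ s⋖t → ⋖-onlyEnds s⋖t w≢s (s≤w , w≤t , w≢t)) , t≤u) , (s≤w , w≢s ∘ sym) , w<₂t
    B×C⇒A : ∀ {w t} → (s <₂ t × t ≤ u) × (s < w × w <₂ t) → (s ≤ w × w ≤ u × w ≢ s) × w <₂ t × t ≤ u
    B×C⇒A ((_ , t≤u) , (s≤w , s≢w) , w<₂t@((w≤t , _) , _)) = (s≤w , ≤-trans w≤t t≤u , s≢w ∘ sym) , w<₂t , t≤u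

  *P-H-expansion : ∀ p {w u} → H w u ≈P 1P +P shift (ΣHtrunc w u) →
    p *P H w u ≈P p +P shift (ΣP (λ t → [ ⌊ w <₂? t ⌋ ∧ ⌊ t ≤? u ⌋ ]P (p *P Htrunc w t)))
  *P-H-expansion p {w} {u} H≈ = begin
    p *P H w u
      ≈⟨ *P-cong {p} ≈P-refl H≈ ⟩
    p *P (1P +P shift (ΣHtrunc w u))
      ≈⟨ *P-distribˡ-+P (p) 1P (shift (ΣHtrunc w u)) ⟩
    p *P 1P +P p *P shift (ΣHtrunc w u)
      ≈⟨ +P-cong (*P-identityʳ (p)) (*P-shiftʳ (p) (ΣHtrunc w u)) ⟩
    p +P shift (p *P ΣHtrunc w u)
      ≈⟨ +P-congˡ {p} (shift-cong (≈P-trans (*P-distribˡ-ΣP (p) (λ t → [ ⌊ w <₂? t ⌋ ∧ ⌊ t ≤? u ⌋ ]P (Htrunc w t)))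
           (ΣP.cong λ t → ΣP.indicator-homomorphic (p *P_) (*P-zeroʳ (p)) (⌊ w <₂? t ⌋ ∧ ⌊ t ≤? u ⌋) (Htrunc w t)))) ⟩
    p +P shift (ΣP (λ t → [ ⌊ w <₂? t ⌋ ∧ ⌊ t ≤? u ⌋ ]P (p *P Htrunc w t))) ∎
    where open ≈P-Reasoning

  H-expansion : ∀ {s u} → s ≤ u → H s u ≈P 1P +P shift (ΣHtrunc s u)
  H-expansion {s} = go (po-noetherian isPartialOrder s)
    where
    go : ∀ {s u} → Acc (flip _<_) s → s ≤ u → H s u ≈P 1P +P shift (ΣHtrunc s u)
    go {s} {u} (acc above) s≤u with s ≟ u
    ... | yes refl = begin
      H s s                       ≈⟨ chow-refl (everything P) ρ s ⟩
      1P                          ≈⟨ +P-identityʳ 1P ⟨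
      1P +P 0P                    ≈⟨ +P-congˡ {1P} (≈P-trans (shift-cong nothing-between) shift-zero) ⟨
      1P +P shift (ΣHtrunc s s)   ∎
      where
      open ≈P-Reasoning
      nothing-between : ΣHtrunc s s ≈P 0P
      nothing-between = ΣP.vanishing λ t → ΣP.indicator-false (⌊⌋-reflects (s <₂? t) ×-reflects ⌊⌋-reflects (t ≤? s))
        λ (((s≤t , s≢t) , _) , t≤s) → s≢t (antisym s≤t t≤s)
    ... | no s≢u = begin
      H s u
        ≈⟨ chow-unfold (everything P) ρ s≢u ⟩
      ΣP (λ w → [ g w ]P (χ̄ s w *P H w u))
        ≈⟨ ΣP.cong expand-summand ⟩
      ΣP (λ w → [ g w ]P (χ̄ s w) +P shift (ΣP (λ t → [ g w ∧ L w t ]P (F w t))))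
        ≈⟨ ΣP.distrib (λ w → [ g w ]P (χ̄ s w)) (λ w → shift (ΣP (λ t → [ g w ∧ L w t ]P (F w t)))) ⟩
      ΣP (λ w → [ g w ]P (χ̄ s w)) +P ΣP (λ w → shift (ΣP (λ t → [ g w ∧ L w t ]P (F w t))))
        ≈⟨ +P-cong (χ̄-row-sum (s≤u , s≢u))
                   (≈P-trans (≈P-sym (shift-ΣP (λ w → ΣP (λ t → [ g w ∧ L w t ]P (F w t))))) (shift-cong (chain-reindex s u F))) ⟩
      (1P +P ΣP (λ t → [ L s t ]P (χ̄ s t +P μ s t ·P 1P))) +P
      shift (ΣP (λ t → [ L s t ]P (ΣP (λ w → [ ⌊ s <? w ⌋ ∧ ⌊ w <₂? t ⌋ ]P (F w t)))))
        ≈⟨ +P-assoc 1P _ _ ⟩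
      1P +P (ΣP (λ t → [ L s t ]P (χ̄ s t +P μ s t ·P 1P)) +P
             shift (ΣP (λ t → [ L s t ]P (ΣP (λ w → [ ⌊ s <? w ⌋ ∧ ⌊ w <₂? t ⌋ ]P (F w t))))))
        ≈⟨ +P-congˡ {1P} (ΣHtrunc-unfold s u) ⟨
      1P +P shift (ΣHtrunc s u) ∎
      where
      open ≈P-Reasoning
      g : Fin n → Bool
      g w = ⌊ s ≤? w ⌋ ∧ ⌊ w ≤? u ⌋ ∧ not ⌊ w ≟ s ⌋
      L : Fin n → Fin n → Bool
      L w t = ⌊ w <₂? t ⌋ ∧ ⌊ t ≤? u ⌋
      F : Fin n → Fin n → Poly
      F w t = χ̄ s w *P Htrunc w t
      expand-summand : ∀ w → [ g w ]P (χ̄ s w *P H w u) ≈P [ g w ]P (χ̄ s w) +P shift (ΣP (λ t → [ g w ∧ L w t ]P (F w t)))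
      expand-summand w = begin
        [ g w ]P (χ̄ s w *P H w u)
          ≈⟨ ΣP.indicator-congʳ (interval∧-reflects (everything P) s u w (≢-reflects w s))
               (λ (_ , s≤w , w≤u , w≢s) → *P-H-expansion (χ̄ s w) (go (above (s≤w , w≢s ∘ sym)) w≤u)) ⟩
        [ g w ]P (χ̄ s w +P shift (ΣP (λ t → [ L w t ]P (F w t))))
          ≈⟨ ΣP.indicator-∙ (g w) (χ̄ s w) _ ⟩
        [ g w ]P (χ̄ s w) +P [ g w ]P (shift (ΣP (λ t → [ L w t ]P (F w t))))
          ≈⟨ +P-congˡ {[ g w ]P (χ̄ s w)} (≈P-trans (≈P-sym (ΣP.indicator-homomorphic shift shift-zero (g w) (ΣP (λ t → [ L w t ]P (F w t)))))
               (shift-cong (≈P-trans (ΣP.indicator-Σ (g w) (λ t → [ L w t ]P (F w t)))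
                 (ΣP.cong λ t → ≈P-reflexive (ΣP.indicator-∧ (g w) (L w t) (F w t)))))) ⟩
        [ g w ]P (χ̄ s w) +P shift (ΣP (λ t → [ g w ∧ L w t ]P (F w t))) ∎

  𝟘<₂⇒1<ρ : ∀ {t} → 𝟘 <₂ t → 1 ℕ.< ρ t
  𝟘<₂⇒1<ρ {t} ((_ , 𝟘≢t) , ¬𝟘⋖t) = ℕ.≤∧≢⇒< (≢𝟘⇒0<ρ (𝟘≢t ∘ sym))
    λ 1≡ρt → ¬𝟘⋖t (ρ≡1+ρ⇒⋖ (𝟘-min t) (trans (sym 1≡ρt) (cong suc (sym ρ-𝟘))))

  1<ρ⇒𝟘<₂ : ∀ {t} → 1 ℕ.< ρ t → 𝟘 <₂ t
  1<ρ⇒𝟘<₂ {t} 1<ρt = (𝟘-min t , λ { refl → ℕ.<⇒≢ (ℕ.<-trans ℕ.0<1+n 1<ρt) (sym ρ-𝟘) })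
                   , λ 𝟘⋖t → ℕ.<⇒≢ 1<ρt (sym (trans (ρ-cover 𝟘 t 𝟘⋖t) (cong suc ρ-𝟘)))

  chowPoly-recursion : chowPoly P ≈P 1P +P xpow 1 *P ΣP (λ t → [ 1 <ᵇ ρ t ]P (chowTrunc P t))
  chowPoly-recursion = begin
    H 𝟘 𝟙
      ≈⟨ H-expansion (𝟘-min 𝟙) ⟩
    1P +P shift (ΣHtrunc 𝟘 𝟙)
      ≈⟨ +P-congˡ {1P} (shift-cong (ΣP.cong top-summand)) ⟩
    1P +P shift (ΣP (λ t → [ 1 <ᵇ ρ t ]P (chowTrunc P t)))
      ≈⟨ +P-congˡ {1P} (x*P≈shift (ΣP (λ t → [ 1 <ᵇ ρ t ]P (chowTrunc P t)))) ⟨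
    1P +P xpow 1 *P ΣP (λ t → [ 1 <ᵇ ρ t ]P (chowTrunc P t)) ∎
    where
    open ≈P-Reasoning
    top-summand : ∀ t → [ ⌊ 𝟘 <₂? t ⌋ ∧ ⌊ t ≤? 𝟙 ⌋ ]P (Htrunc 𝟘 t) ≈P [ 1 <ᵇ ρ t ]P (chowTrunc P t)
    top-summand t = ΣP.indicator-cong (⌊⌋-reflects (𝟘 <₂? t) ×-reflects ⌊⌋-reflects (t ≤? 𝟙)) (T-reflects (1 <ᵇ ρ t))
      (λ (𝟘<₂t , _) → ℕ.<⇒<ᵇ (𝟘<₂⇒1<ρ 𝟘<₂t))
      (λ 1<ᵇρt → 1<ρ⇒𝟘<₂ (ℕ.<ᵇ⇒< 1 (ρ t) 1<ᵇρt) , 𝟙-max t)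
      (λ ((_ , ¬𝟘⋖t) , _) → ≈P-reflexive (cong (λ b → chow P (trunc P t) (truncRank P t) b t)
                                                (sym (if-⌊⌋-no (covers? P 𝟘 t) ¬𝟘⋖t))))

  -- The augmented χ-Chow polynomial

  rank-generating : ΣP (λ w → xpow (ρ w)) ≈P 1P +P shift (ΣP (λ t → [ not ⌊ t ≟ 𝟘 ⌋ ]P (xpow (ρ t ∸ 1))))
  rank-generating = begin
    ΣP (λ w → xpow (ρ w))
      ≈⟨ ΣP.split 𝟘 (λ w → xpow (ρ w)) ⟩
    xpow (ρ 𝟘) +P ΣP (λ t → [ not ⌊ t ≟ 𝟘 ⌋ ]P (xpow (ρ t)))
      ≈⟨ +P-cong (≈P-reflexive (cong xpow ρ-𝟘)) (ΣP.cong lower-rank) ⟩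
    1P +P ΣP (λ t → shift ([ not ⌊ t ≟ 𝟘 ⌋ ]P (xpow (ρ t ∸ 1))))
      ≈⟨ +P-congˡ {1P} (shift-ΣP (λ t → [ not ⌊ t ≟ 𝟘 ⌋ ]P (xpow (ρ t ∸ 1)))) ⟨
    1P +P shift (ΣP (λ t → [ not ⌊ t ≟ 𝟘 ⌋ ]P (xpow (ρ t ∸ 1)))) ∎
    where
    open ≈P-Reasoning
    lower-rank : ∀ t → [ not ⌊ t ≟ 𝟘 ⌋ ]P (xpow (ρ t)) ≈P shift ([ not ⌊ t ≟ 𝟘 ⌋ ]P (xpow (ρ t ∸ 1)))
    lower-rank t = ≈P-trans
      (ΣP.indicator-congʳ (≢-reflects t 𝟘) λ t≢𝟘 →
        ≈P-trans (≈P-reflexive (cong xpow (sym (ℕ.m+[n∸m]≡n (≢𝟘⇒0<ρ t≢𝟘))))) (xpow-suc (ρ t ∸ 1)))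
      (≈P-sym (ΣP.indicator-homomorphic shift shift-zero (not ⌊ t ≟ 𝟘 ⌋) (xpow (ρ t ∸ 1))))

  augChow-top : ∀ S r {b t} → T (S t) → b ≤ t →
    augChow P S r b t ≈P
    xpow (r t ∸ r b) +P ΣP (λ w → [ not ⌊ w ≟ t ⌋ ]P ([ S w ∧ ⌊ b ≤? w ⌋ ∧ ⌊ w ≤? t ⌋ ]P (xpow (r w ∸ r b) *P chow P S r w t)))
  augChow-top S r {b} {t} St b≤t = ≈P-trans
    (ΣP.split t (λ w → [ S w ∧ ⌊ b ≤? w ⌋ ∧ ⌊ w ≤? t ⌋ ]P (xpow (r w ∸ r b) *P chow P S r w t)))
    (+P-congʳ (≈P-trans (ΣP.indicator-true (interval-reflects S b t t) (St , b≤t , ≤-refl))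
              (≈P-trans (*P-cong {xpow (r t ∸ r b)} ≈P-refl (chow-refl S r t)) (*P-identityʳ (xpow (r t ∸ r b))))))

  augChowTrunc-expansion : ∀ {t} → t ≢ 𝟘 →
    augChowTrunc P t ≈P xpow (ρ t ∸ 1) +P ΣP (λ w → [ ⌊ w <₂? t ⌋ ∧ ⌊ t ≤? 𝟙 ⌋ ]P (xpow (ρ w) *P Htrunc w t))
  augChowTrunc-expansion {t} t≢𝟘 = with-bottom (covers? P 𝟘 t)
    where
    t∈trunc : T (trunc P t t)
    t∈trunc = T-intro (trunc-reflects t t) (≤-refl , λ (_ , t≢t , _) → t≢t refl)
    g-reflects : ∀ b w → Reflects (w ≢ t × (w ≤ t × ¬ w ⋖ t) × b ≤ w × w ≤ t)
                                   (not ⌊ w ≟ t ⌋ ∧ trunc P t w ∧ ⌊ b ≤? w ⌋ ∧ ⌊ w ≤? t ⌋)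
    g-reflects b w = ≢-reflects w t ×-reflects trunc-reflects t w ×-reflects ⌊⌋-reflects (b ≤? w) ×-reflects ⌊⌋-reflects (w ≤? t)
    L-reflects : ∀ w → Reflects (w <₂ t × t ≤ 𝟙) (⌊ w <₂? t ⌋ ∧ ⌊ t ≤? 𝟙 ⌋)
    L-reflects w = ⌊⌋-reflects (w <₂? t) ×-reflects ⌊⌋-reflects (t ≤? 𝟙)
    with-bottom : Dec (𝟘 ⋖ t) →
      augChowTrunc P t ≈P xpow (ρ t ∸ 1) +P ΣP (λ w → [ ⌊ w <₂? t ⌋ ∧ ⌊ t ≤? 𝟙 ⌋ ]P (xpow (ρ w) *P Htrunc w t))
    with-bottom (yes 𝟘⋖t) = begin
      augChowTrunc P t
        ≡⟨ cong (λ b → augChow P (trunc P t) (truncRank P t) b t) (if-⌊⌋-yes (covers? P 𝟘 t) 𝟘⋖t) ⟩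
      augChow P (trunc P t) (truncRank P t) t t
        ≈⟨ augChow-top (trunc P t) (truncRank P t) t∈trunc ≤-refl ⟩
      xpow (truncRank P t t ∸ truncRank P t t) +P _
        ≈⟨ +P-cong (≈P-reflexive (cong xpow (trans (ℕ.n∸n≡0 (truncRank P t t)) (sym ρt∸1≡0))))
                   (ΣP.cong λ w → ≈P-trans (≈P-reflexive (ΣP.indicator-∧ (not ⌊ w ≟ t ⌋) _ _))
                     (ΣP.indicator-cong (g-reflects t w) (L-reflects w)
                       (λ (w≢t , _ , t≤w , w≤t) → contradiction (antisym w≤t t≤w) w≢t)
                       (λ ((w<t , ¬w⋖t) , _) → contradiction (subst (_⋖ t) (sym (below-atom w<t)) 𝟘⋖t) ¬w⋖t)
                       (λ (w≢t , _ , t≤w , w≤t) → contradiction (antisym w≤t t≤w) w≢t))) ⟩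
      xpow (ρ t ∸ 1) +P ΣP (λ w → [ ⌊ w <₂? t ⌋ ∧ ⌊ t ≤? 𝟙 ⌋ ]P (xpow (ρ w) *P Htrunc w t)) ∎
      where
      open ≈P-Reasoning
      ρt≡1 : ρ t ≡ 1
      ρt≡1 = trans (ρ-cover 𝟘 t 𝟘⋖t) (cong suc ρ-𝟘)
      ρt∸1≡0 : ρ t ∸ 1 ≡ 0
      ρt∸1≡0 = cong (_∸ 1) ρt≡1
      below-atom : ∀ {w} → w < t → w ≡ 𝟘
      below-atom w<t = ρ≡0⇒≡𝟘 (ℕ.n<1⇒n≡0 (subst (ρ _ ℕ.<_) ρt≡1 (ρ-strictMono w<t)))
    with-bottom (no ¬𝟘⋖t) = begin
      augChowTrunc P t
        ≡⟨ cong (λ b → augChow P (trunc P t) (truncRank P t) b t) (if-⌊⌋-no (covers? P 𝟘 t) ¬𝟘⋖t) ⟩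
      augChow P (trunc P t) (truncRank P t) 𝟘 t
        ≈⟨ augChow-top (trunc P t) (truncRank P t) t∈trunc (𝟘-min t) ⟩
      xpow (truncRank P t t ∸ truncRank P t 𝟘) +P _
        ≈⟨ +P-cong (≈P-reflexive (cong xpow (trans (truncRank-∸ (t≢𝟘 ∘ sym)) (cong (λ r → ρ t ∸ r ∸ 1) ρ-𝟘))))
                   (ΣP.cong λ w → ≈P-trans (≈P-reflexive (ΣP.indicator-∧ (not ⌊ w ≟ t ⌋) _ _))
                     (ΣP.indicator-cong (g-reflects 𝟘 w) (L-reflects w)
                       (λ (w≢t , (w≤t , ¬w⋖t) , _) → ((w≤t , w≢t) , ¬w⋖t) , 𝟙-max t)
                       (λ (((w≤t , w≢t) , ¬w⋖t) , _) → w≢t , (w≤t , ¬w⋖t) , 𝟘-min w , w≤t)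
                       (λ (w≢t , _) → *P-cong {q = Htrunc w t} (≈P-reflexive (cong xpow
                          (cong₂ _∸_ (truncRank-below w≢t) (trans (truncRank-below (t≢𝟘 ∘ sym)) ρ-𝟘)))) ≈P-refl))) ⟩
      xpow (ρ t ∸ 1) +P ΣP (λ w → [ ⌊ w <₂? t ⌋ ∧ ⌊ t ≤? 𝟙 ⌋ ]P (xpow (ρ w) *P Htrunc w t)) ∎
      where open ≈P-Reasoning

  augChowTrunc-guarded : ∀ t →
    [ not ⌊ t ≟ 𝟘 ⌋ ]P (xpow (ρ t ∸ 1)) +P ΣP (λ w → [ ⌊ w <₂? t ⌋ ∧ ⌊ t ≤? 𝟙 ⌋ ]P (xpow (ρ w) *P Htrunc w t)) ≈P
    [ not ⌊ t ≟ 𝟘 ⌋ ]P (augChowTrunc P t)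
  augChowTrunc-guarded t = with-zero (t ≟ 𝟘)
    where
    open ≈P-Reasoning
    with-zero : Dec (t ≡ 𝟘) →
      [ not ⌊ t ≟ 𝟘 ⌋ ]P (xpow (ρ t ∸ 1)) +P ΣP (λ w → [ ⌊ w <₂? t ⌋ ∧ ⌊ t ≤? 𝟙 ⌋ ]P (xpow (ρ w) *P Htrunc w t)) ≈P
      [ not ⌊ t ≟ 𝟘 ⌋ ]P (augChowTrunc P t)
    with-zero (yes refl) = begin
      [ not ⌊ t ≟ 𝟘 ⌋ ]P (xpow (ρ t ∸ 1)) +P ΣP (λ w → [ ⌊ w <₂? t ⌋ ∧ ⌊ t ≤? 𝟙 ⌋ ]P (xpow (ρ w) *P Htrunc w t))
        ≈⟨ +P-cong (ΣP.indicator-false (≢-reflects t 𝟘) (λ t≢𝟘 → t≢𝟘 refl))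
                   (ΣP.vanishing λ w → ΣP.indicator-false (⌊⌋-reflects (w <₂? t) ×-reflects ⌊⌋-reflects (t ≤? 𝟙))
                      λ (((w≤t , w≢t) , _) , _) → w≢t (antisym w≤t (𝟘-min w))) ⟩
      0P +P 0P
        ≈⟨ +P-identityʳ 0P ⟩
      0P
        ≈⟨ ΣP.indicator-false (≢-reflects t 𝟘) (λ t≢𝟘 → t≢𝟘 refl) ⟨
      [ not ⌊ t ≟ 𝟘 ⌋ ]P (augChowTrunc P t) ∎
    with-zero (no t≢𝟘) = begin
      [ not ⌊ t ≟ 𝟘 ⌋ ]P (xpow (ρ t ∸ 1)) +P ΣP (λ w → [ ⌊ w <₂? t ⌋ ∧ ⌊ t ≤? 𝟙 ⌋ ]P (xpow (ρ w) *P Htrunc w t))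
        ≈⟨ +P-congʳ (ΣP.indicator-true (≢-reflects t 𝟘) t≢𝟘) ⟩
      xpow (ρ t ∸ 1) +P ΣP (λ w → [ ⌊ w <₂? t ⌋ ∧ ⌊ t ≤? 𝟙 ⌋ ]P (xpow (ρ w) *P Htrunc w t))
        ≈⟨ augChowTrunc-expansion t≢𝟘 ⟨
      augChowTrunc P t
        ≈⟨ ΣP.indicator-true (≢-reflects t 𝟘) t≢𝟘 ⟨
      [ not ⌊ t ≟ 𝟘 ⌋ ]P (augChowTrunc P t) ∎

  augChowPoly-recursion : augChowPoly P ≈P 1P +P xpow 1 *P ΣP (λ t → [ not ⌊ t ≟ 𝟘 ⌋ ]P (augChowTrunc P t))
  augChowPoly-recursion = begin
    augChowPoly P
      ≈⟨ ΣP.cong expand-summand ⟩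
    ΣP (λ w → xpow (ρ w) +P shift (ΣP (λ t → [ L w t ]P (Y w t))))
      ≈⟨ ΣP.distrib (λ w → xpow (ρ w)) (λ w → shift (ΣP (λ t → [ L w t ]P (Y w t)))) ⟩
    ΣP (λ w → xpow (ρ w)) +P ΣP (λ w → shift (ΣP (λ t → [ L w t ]P (Y w t))))
      ≈⟨ +P-cong rank-generating (≈P-trans (≈P-sym (shift-ΣP (λ w → ΣP (λ t → [ L w t ]P (Y w t)))))
                                           (shift-cong (ΣP.comm (λ w t → [ L w t ]P (Y w t))))) ⟩
    (1P +P shift (ΣP X)) +P shift (ΣP (λ t → ΣP (λ w → [ L w t ]P (Y w t))))
      ≈⟨ +P-assoc 1P _ _ ⟩
    1P +P (shift (ΣP X) +P shift (ΣP (λ t → ΣP (λ w → [ L w t ]P (Y w t)))))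
      ≈⟨ +P-congˡ {1P} (≈P-trans (≈P-sym (shift-+ (ΣP X) _))
           (shift-cong (≈P-sym (ΣP.distrib X (λ t → ΣP (λ w → [ L w t ]P (Y w t))))))) ⟩
    1P +P shift (ΣP (λ t → X t +P ΣP (λ w → [ L w t ]P (Y w t))))
      ≈⟨ +P-congˡ {1P} (shift-cong (ΣP.cong augChowTrunc-guarded)) ⟩
    1P +P shift (ΣP (λ t → [ not ⌊ t ≟ 𝟘 ⌋ ]P (augChowTrunc P t)))
      ≈⟨ +P-congˡ {1P} (x*P≈shift (ΣP (λ t → [ not ⌊ t ≟ 𝟘 ⌋ ]P (augChowTrunc P t)))) ⟨
    1P +P xpow 1 *P ΣP (λ t → [ not ⌊ t ≟ 𝟘 ⌋ ]P (augChowTrunc P t)) ∎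
    where
    open ≈P-Reasoning
    L : Fin n → Fin n → Bool
    L w t = ⌊ w <₂? t ⌋ ∧ ⌊ t ≤? 𝟙 ⌋
    Y : Fin n → Fin n → Poly
    Y w t = xpow (ρ w) *P Htrunc w t
    X : Fin n → Poly
    X t = [ not ⌊ t ≟ 𝟘 ⌋ ]P (xpow (ρ t ∸ 1))
    expand-summand : ∀ w → [ ⌊ 𝟘 ≤? w ⌋ ∧ ⌊ w ≤? 𝟙 ⌋ ]P (xpow (ρ w ∸ ρ 𝟘) *P H w 𝟙) ≈P
                           xpow (ρ w) +P shift (ΣP (λ t → [ L w t ]P (Y w t)))
    expand-summand w = begin
      [ ⌊ 𝟘 ≤? w ⌋ ∧ ⌊ w ≤? 𝟙 ⌋ ]P (xpow (ρ w ∸ ρ 𝟘) *P H w 𝟙)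
        ≈⟨ ΣP.indicator-true (interval-reflects (everything P) 𝟘 𝟙 w) (_ , 𝟘-min w , 𝟙-max w) ⟩
      xpow (ρ w ∸ ρ 𝟘) *P H w 𝟙
        ≡⟨ cong (λ r → xpow (ρ w ∸ r) *P H w 𝟙) ρ-𝟘 ⟩
      xpow (ρ w) *P H w 𝟙
        ≈⟨ *P-H-expansion (xpow (ρ w)) (H-expansion (𝟙-max w)) ⟩
      xpow (ρ w) +P shift (ΣP (λ t → [ L w t ]P (Y w t))) ∎

proposition4p12 : (P : FinGradedBoundedPoset) →
    let open FinGradedBoundedPoset P in
    (chowPoly P ≈P 1P +P xpow 1 *P ΣP (λ t → [ 1 <ᵇ ρ t ]P (chowTrunc P t)))
    × (augChowPoly P ≈P 1P +P xpow 1 *P ΣP (λ t → [ not ⌊ t ≟ 𝟘 ⌋ ]P (augChowTrunc P t)))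
proposition4p12 P = chowPoly-recursion P , augChowPoly-recursion P
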